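{- The reduction relation $\to_p \;=\; \to_\bullet \cup \to_m \cup \to_r$ of the Pure Pattern Calculus with Explicit Matching ($PPC_{EM}$), applied in any context, is confluent and strongly normalizing.
   Context: Fix an infinite set of names; $\theta$ denotes a list of names. Terms of $PPC_{EM}$ are $t ::= x \mid \hat{x} \mid t\,t \mid t\bullet t \mid [\theta]\,t \to t \mid t\langle\theta \mid \mu \mid \Delta\rangle$, where $x$ ranges over names ($x$ is a variable occurrence, $\hat x$ a matchable occurrence), $t_1 t_2$ is (functional) application, $t_1\bullet t_2$ is explicit structural application, $[\theta]\,p\to b$ is a pattern abstraction, and $b\langle\theta\mid\mu\mid\Delta\rangle$ is an explicit matching in which $\mu$ is a decided match (either the failure symbol $\bot$ or a substitution, i.e. a finite map from names to terms) and $\Delta$ is a finite multiset of pairs of terms $(a,p)$. Data structures are $d ::= \hat x \mid t\bullet t$; matchable forms are $m ::= d \mid [\theta]\,t\to t$. The symbol $\bot$ used as a term denotes a fixed closed normal term without $\bullet$ or explicit matchings. Free variables: $fv(x)=\{x\}$, $fv(\hat x)=\emptyset$, $fv(t_1t_2)=fv(t_1\bullet t_2)=fv(t_1)\cup fv(t_2)$, $fv([\theta]p\to b)=fv(p)\cup(fv(b)\setminus\theta)$, $fv(t\langle\theta\mid\mu\mid\Delta\rangle)=(fv(t)\setminus\theta)\cup fv(\mathrm{codom}(\mu))\cup fv(\Delta)$. Free matchables: $fm(x)=\emptyset$, $fm(\hat x)=\{x\}$, $fm(t_1t_2)=fm(t_1\bullet t_2)=fm(t_1)\cup fm(t_2)$,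 $fm([\theta]p\to b)=(fm(p)\setminus\theta)\cup fm(b)$, $fm(t\langle\theta\mid\mu\mid\Delta\rangle)=fm(t)\cup fm(\mathrm{codom}(\mu))\cup\bigcup_{(a,p)\in\Delta}fm(a)\cup(\bigcup_{(a,p)\in\Delta}fm(p)\setminus\theta)$. Free names $fn=fv\cup fm$. Terms are taken up to $\alpha$-conversion of bound names, and all bound names are assumed distinct and disjoint from free names. Substitution $t^\sigma$ replaces free variable occurrences $x\in dom(\sigma)$ by $\sigma(x)$, leaves matchables unchanged, commutes with all constructors, and propagates into the codomain of $\mu$ and into all terms of $\Delta$ (capture-avoiding: bound $\theta$ disjoint from $dom(\sigma)$ and from free names of $\sigma$). Disjoint union $\uplus$ of decided matches: commutative, $\bot\uplus\mu=\bot$, $\sigma_1\uplus\sigma_2=\bot$ if their domains overlap, and the union of $\sigma_1,\sigma_2$ otherwise. Writing $(a,p)\Delta$ for the multiset union of $\Delta$ with $\{(a,p)\}$, the rules are: (B) $([\theta]p\to b)\,a \to_B b\langle\theta\mid\emptyset\mid(a,p)\rangle$; ($\bullet$) $\hat x\,t\to_\bullet \hat x\bullet t$ and $(t_1\bullet t_2)\,t_3\to_\bullet(t_1\bullet t_2)\bullet t_3$; (m) $b\langle\theta\mid\mu\mid(a,\hat x)\Delta\rangle\to_m b\langle\theta\mid\mu\uplus\{x\mapsto a\}\mid\Delta\rangle$ if $x\in\theta$ and $fn(a)\cap\theta=\emptyset$; $b\langle\theta\mid\mu\mid(\hat x,\hat x)\Delta\rangle\to_m b\langle\theta\mid\mu\mid\Delta\rangle$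 if $x\notin\theta$; $b\langle\theta\mid\mu\mid(a_1\bullet a_2,p_1\bullet p_2)\Delta\rangle\to_m b\langle\theta\mid\mu\mid(a_1,p_1)(a_2,p_2)\Delta\rangle$; and $b\langle\theta\mid\mu\mid(a,p)\Delta\rangle\to_m b\langle\theta\mid\bot\mid\Delta\rangle$ in each of the cases: $a=\hat y,p=\hat x$ with $x\notin\theta$, $x\neq y$; $a=a_1\bullet a_2$, $p=\hat x$, $x\notin\theta$; $a$ an abstraction, $p=\hat x$, $x\notin\theta$; $a=\hat x$, $p=p_1\bullet p_2$; $a$ an abstraction, $p=p_1\bullet p_2$; $p$ an abstraction (any $a$). (r) $b\langle\theta\mid\sigma\mid\emptyset\rangle\to_r b^\sigma$ if $dom(\sigma)=\theta$; $b\langle\theta\mid\sigma\mid\emptyset\rangle\to_r\bot$ if $dom(\sigma)\neq\theta$; $b\langle\theta\mid\bot\mid\Delta\rangle\to_r\bot$. Each rule may be applied in any context (including inside $\mu$ and $\Delta$). -}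

module Defs where

-- Pure Pattern Calculus with Explicit Matching (PPC_EM), in a two-sorted
-- de Bruijn (nameless) representation, so that alpha-conversion is identity.
--
-- A binder [θ] binds k = length θ names at once.  Variable occurrences and
-- matchable occurrences have SEPARATE index spaces:
--   * [θ] p → b    : θ binds matchables in p (k extra matchable binders)
--                    and variables in b (k extra variable binders);
--   * b⟨θ | μ | Δ⟩ : θ binds variables in b and matchables in the patterns
--                    p of Δ; nothing in μ's codomain nor in the arguments a.
-- An index i < k under such a binder denotes the i-th name of θ; larger
-- indices are shifted by k.
-- Decided matches μ : Maybe (Vec (Maybe Term) k) where
--   nothing        = the failure symbol ⊥,
--   just σ         = the substitution σ with domain {i | σ[i] = just _} ⊆ θ.
-- Δ is a list of pairs (a , p) (multiset, rules act at any position).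

open import Data.Nat using (ℕ; zero; suc; _+_; _∸_; _≤_; _<_; _<ᵇ_)
open import Data.Bool using (true; false)
open import Data.Fin using (Fin; toℕ)
open import Data.Maybe using (Maybe; just; nothing)
open import Data.Vec using (Vec; []; _∷_; lookup; _[_]≔_; replicate)
open import Data.List using (List; []; _∷_; _++_)
open import Data.Product using (_×_; _,_; ∃-syntax)
open import Data.Sum using (_⊎_)
open import Data.Unit using (⊤)
open import Data.Empty using (⊥)
open import Relation.Nullary using (¬_)
open import Relation.Binary.PropositionalEquality using (_≡_; _≢_)
open import Relation.Binary.Construct.Closure.ReflexiveTransitive using (Star)
open import Induction.WellFounded using (WellFounded)
open import Function using (flip)

data Term : Set where
  var  : ℕ → Term
  mat  : ℕ → Term
  app  : Term → Term → Term
  sapp : Term → Term → Term             -- t • t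
  abs  : (k : ℕ) → Term → Term → Term   -- [θ] p → b   (k = |θ|)
  em   : (k : ℕ) → Term → Maybe (Vec (Maybe Term) k)
       → List (Term × Term) → Term      -- b ⟨θ | μ | Δ⟩

DMatch : ℕ → Set
DMatch k = Maybe (Vec (Maybe Term) k)

mutual
  shV : ℕ → ℕ → Term → Term
  shV c d (var i) with i <ᵇ c
  ... | true  = var i
  ... | false = var (i + d)
  shV c d (mat i) = mat i
  shV c d (app s t) = app (shV c d s) (shV c d t)
  shV c d (sapp s t) = sapp (shV c d s) (shV c d t)
  shV c d (abs k p b) = abs k (shV c d p) (shV (k + c) d b)
  shV c d (em k b μ Δ) = em k (shV (k + c) d b) (shVμ c d μ) (shVΔ c d Δ)

  shVμ : ∀ {k} → ℕ → ℕ → DMatch k → DMatch k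
  shVμ c d nothing = nothing
  shVμ c d (just σ) = just (shVv c d σ)

  shVv : ∀ {k} → ℕ → ℕ → Vec (Maybe Term) k → Vec (Maybe Term) k
  shVv c d [] = []
  shVv c d (nothing ∷ σ) = nothing ∷ shVv c d σ
  shVv c d (just t ∷ σ) = just (shV c d t) ∷ shVv c d σ

  shVΔ : ℕ → ℕ → List (Term × Term) → List (Term × Term)
  shVΔ c d [] = []
  shVΔ c d ((a , p) ∷ Δ) = (shV c d a , shV c d p) ∷ shVΔ c d Δ

mutual
  shM : ℕ → ℕ → Term → Term
  shM c d (var i) = var i
  shM c d (mat i) with i <ᵇ c
  ... | true  = mat i
  ... | false = mat (i + d)
  shM c d (app s t) = app (shM c d s) (shM c d t)
  shM c d (sapp s t) = sapp (shM c d s) (shM c d t)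
  shM c d (abs k p b) = abs k (shM (k + c) d p) (shM c d b)
  shM c d (em k b μ Δ) = em k (shM c d b) (shMμ c d μ) (shMΔ k c d Δ)

  shMμ : ∀ {k} → ℕ → ℕ → DMatch k → DMatch k
  shMμ c d nothing = nothing
  shMμ c d (just σ) = just (shMv c d σ)

  shMv : ∀ {k} → ℕ → ℕ → Vec (Maybe Term) k → Vec (Maybe Term) k
  shMv c d [] = []
  shMv c d (nothing ∷ σ) = nothing ∷ shMv c d σ
  shMv c d (just t ∷ σ) = just (shM c d t) ∷ shMv c d σ

  -- patterns of Δ are under the k matchable binders of θ
  shMΔ : ℕ → ℕ → ℕ → List (Term × Term) → List (Term × Term)
  shMΔ k c d [] = []
  shMΔ k c d ((a , p) ∷ Δ) = (shM c d a , shM (k + c) d p) ∷ shMΔ k c d Δ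

-- Substitution b^σ of the k outermost bound variables by σ : Vec Term k.
-- sub c m σ t : t lies under c further variable binders and m further
-- matchable binders (relative to the binder θ being eliminated).

lookupℕ : ∀ {A : Set} {k} → Vec A k → ℕ → Maybe A
lookupℕ [] i = nothing
lookupℕ (x ∷ xs) zero = just x
lookupℕ (x ∷ xs) (suc i) = lookupℕ xs i

mutual
  sub : ∀ {k} → ℕ → ℕ → Vec Term k → Term → Term
  sub {k} c m σ (var i) with i <ᵇ c
  ... | true  = var i
  ... | false with lookupℕ σ (i ∸ c)
  ...   | just u  = shV 0 c (shM 0 m u)
  ...   | nothing = var (i ∸ k)
  sub c m σ (mat i) = mat i
  sub c m σ (app s t) = app (sub c m σ s) (sub c m σ t)
  sub c m σ (sapp s t) = sapp (sub c m σ s) (sub c m σ t)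
  sub c m σ (abs j p b) = abs j (sub c (j + m) σ p) (sub (j + c) m σ b)
  sub c m σ (em j b μ Δ) = em j (sub (j + c) m σ b) (subμ c m σ μ) (subΔ j c m σ Δ)

  subμ : ∀ {k j} → ℕ → ℕ → Vec Term k → DMatch j → DMatch j
  subμ c m σ nothing = nothing
  subμ c m σ (just τ) = just (subv c m σ τ)

  subv : ∀ {k j} → ℕ → ℕ → Vec Term k → Vec (Maybe Term) j → Vec (Maybe Term) j
  subv c m σ [] = []
  subv c m σ (nothing ∷ τ) = nothing ∷ subv c m σ τ
  subv c m σ (just t ∷ τ) = just (sub c m σ t) ∷ subv c m σ τ

  subΔ : ∀ {k} → ℕ → ℕ → ℕ → Vec Term k → List (Term × Term) → List (Term × Term)
  subΔ j c m σ [] = []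
  subΔ j c m σ ((a , p) ∷ Δ) = (sub c m σ a , sub c (j + m) σ p) ∷ subΔ j c m σ Δ

substTop : ∀ {k} → Vec Term k → Term → Term
substTop σ b = sub 0 0 σ b

extend : ∀ {k} → DMatch k → Fin k → Term → DMatch k
extend nothing x a = nothing
extend (just σ) x a with lookup σ x
... | just _  = nothing
... | nothing = just (σ [ x ]≔ just a)

allJust : ∀ {k} → Vec (Maybe Term) k → Maybe (Vec Term k)
allJust [] = just []
allJust (nothing ∷ σ) = nothing
allJust (just t ∷ σ) with allJust σ
... | nothing = nothing
... | just τ  = just (t ∷ τ)

emptyM : ∀ k → DMatch k
emptyM k = just (replicate k nothing)

Rel : Set₁
Rel = Term → Term → Set

mutual
  data Step (R : Rel) : Term → Term → Set where
    root  : ∀ {s t} → R s t → Step R s t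
    appL  : ∀ {s s' t} → Step R s s' → Step R (app s t) (app s' t)
    appR  : ∀ {s t t'} → Step R t t' → Step R (app s t) (app s t')
    sappL : ∀ {s s' t} → Step R s s' → Step R (sapp s t) (sapp s' t)
    sappR : ∀ {s t t'} → Step R t t' → Step R (sapp s t) (sapp s t')
    absP  : ∀ {k p p' b} → Step R p p' → Step R (abs k p b) (abs k p' b)
    absB  : ∀ {k p b b'} → Step R b b' → Step R (abs k p b) (abs k p b')
    emB   : ∀ {k b b' μ Δ} → Step R b b' → Step R (em k b μ Δ) (em k b' μ Δ)
    emμ   : ∀ {k b σ σ' Δ} → StepV R σ σ' →
            Step R (em k b (just σ) Δ) (em k b (just σ') Δ)
    emΔ   : ∀ {k b μ Δ Δ'} → StepΔ R Δ Δ' → Step R (em k b μ Δ) (em k b μ Δ')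

  data StepV (R : Rel) : ∀ {k} → Vec (Maybe Term) k → Vec (Maybe Term) k → Set where
    here  : ∀ {k s t} {σ : Vec (Maybe Term) k} → Step R s t →
            StepV R (just s ∷ σ) (just t ∷ σ)
    there : ∀ {k x} {σ σ' : Vec (Maybe Term) k} → StepV R σ σ' →
            StepV R (x ∷ σ) (x ∷ σ')

  data StepΔ (R : Rel) : List (Term × Term) → List (Term × Term) → Set where
    fstS  : ∀ {a a' p Δ} → Step R a a' → StepΔ R ((a , p) ∷ Δ) ((a' , p) ∷ Δ)
    sndS  : ∀ {a p p' Δ} → Step R p p' → StepΔ R ((a , p) ∷ Δ) ((a , p') ∷ Δ)
    there : ∀ {x Δ Δ'} → StepΔ R Δ Δ' → StepΔ R (x ∷ Δ) (x ∷ Δ')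

-- matching failure cases of rule (m); k = |θ|, pattern p lives under θ's
-- matchable binders, so a free matchable ŷ of a corresponds to index k + y
-- in p, and "x ∉ θ" for a pattern index x means k ≤ x.
data Fails (k : ℕ) : Term → Term → Set where
  mat-mat   : ∀ {x y} → k ≤ x → x ≢ k + y → Fails k (mat y) (mat x)
  sapp-mat  : ∀ {a₁ a₂ x} → k ≤ x → Fails k (sapp a₁ a₂) (mat x)
  abs-mat   : ∀ {j q c x} → k ≤ x → Fails k (abs j q c) (mat x)
  mat-sapp  : ∀ {y p₁ p₂} → Fails k (mat y) (sapp p₁ p₂)
  abs-sapp  : ∀ {j q c p₁ p₂} → Fails k (abs j q c) (sapp p₁ p₂)
  any-abs   : ∀ {a j q c} → Fails k a (abs j q c)

-- rules (•), (m), (r); ⊥ (as a term) is the parameter bot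
data PRoot (bot : Term) : Term → Term → Set where
  bullet-mat  : ∀ {x t} → PRoot bot (app (mat x) t) (sapp (mat x) t)
  bullet-sapp : ∀ {t₁ t₂ t₃} →
                PRoot bot (app (sapp t₁ t₂) t₃) (sapp (sapp t₁ t₂) t₃)
  m-bind      : ∀ {k b μ Δ₁ Δ₂ a} (x : Fin k) →
                PRoot bot (em k b μ (Δ₁ ++ (a , mat (toℕ x)) ∷ Δ₂))
                          (em k b (extend μ x a) (Δ₁ ++ Δ₂))
  m-same      : ∀ {k b μ Δ₁ Δ₂ y} →
                PRoot bot (em k b μ (Δ₁ ++ (mat y , mat (k + y)) ∷ Δ₂))
                          (em k b μ (Δ₁ ++ Δ₂))
  m-decomp    : ∀ {k b μ Δ₁ Δ₂ a₁ a₂ p₁ p₂} →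
                PRoot bot (em k b μ (Δ₁ ++ (sapp a₁ a₂ , sapp p₁ p₂) ∷ Δ₂))
                          (em k b μ (Δ₁ ++ (a₁ , p₁) ∷ (a₂ , p₂) ∷ Δ₂))
  m-fail      : ∀ {k b μ Δ₁ Δ₂ a p} → Fails k a p →
                PRoot bot (em k b μ (Δ₁ ++ (a , p) ∷ Δ₂))
                          (em k b nothing (Δ₁ ++ Δ₂))
  r-subst     : ∀ {k b σ τ} → allJust σ ≡ just τ →
                PRoot bot (em k b (just σ) []) (substTop τ b)
  r-dom       : ∀ {k b σ} → allJust σ ≡ nothing →
                PRoot bot (em k b (just σ) []) bot
  r-fail      : ∀ {k b Δ} → PRoot bot (em k b nothing Δ) bot

data BRoot : Term → Term → Set where
  beta : ∀ {k p b a} →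
         BRoot (app (abs k p b) a) (em k b (emptyM k) ((a , p) ∷ []))

_⟶p[_]_ : Term → Term → Term → Set
s ⟶p[ bot ] t = Step (PRoot bot) s t

_⟶[_]_ : Term → Term → Term → Set
s ⟶[ bot ] t = Step (λ u v → BRoot u v ⊎ PRoot bot u v) s t

mutual
  Scoped : ℕ → ℕ → Term → Set
  Scoped nv nm (var i) = i < nv
  Scoped nv nm (mat i) = i < nm
  Scoped nv nm (app s t) = Scoped nv nm s × Scoped nv nm t
  Scoped nv nm (sapp s t) = Scoped nv nm s × Scoped nv nm t
  Scoped nv nm (abs k p b) = Scoped nv (k + nm) p × Scoped (k + nv) nm b
  Scoped nv nm (em k b μ Δ) =
    Scoped (k + nv) nm b × ScopedM nv nm μ × ScopedΔ k nv nm Δ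

  ScopedM : ∀ {k} → ℕ → ℕ → DMatch k → Set
  ScopedM nv nm nothing = ⊤
  ScopedM nv nm (just σ) = ScopedV nv nm σ

  ScopedV : ∀ {k} → ℕ → ℕ → Vec (Maybe Term) k → Set
  ScopedV nv nm [] = ⊤
  ScopedV nv nm (nothing ∷ σ) = ScopedV nv nm σ
  ScopedV nv nm (just t ∷ σ) = Scoped nv nm t × ScopedV nv nm σ

  ScopedΔ : ℕ → ℕ → ℕ → List (Term × Term) → Set
  ScopedΔ k nv nm [] = ⊤
  ScopedΔ k nv nm ((a , p) ∷ Δ) =
    Scoped nv nm a × Scoped nv (k + nm) p × ScopedΔ k nv nm Δ

Closed : Term → Set
Closed t = Scoped 0 0 t

NoSappEm : Term → Set
NoSappEm (var i) = ⊤
NoSappEm (mat i) = ⊤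
NoSappEm (app s t) = NoSappEm s × NoSappEm t
NoSappEm (sapp s t) = ⊥
NoSappEm (abs k p b) = NoSappEm p × NoSappEm b
NoSappEm (em k b μ Δ) = ⊥

Normal : Rel → Term → Set
Normal R t = ∀ u → ¬ R t u

Confluent : Rel → Set
Confluent R = ∀ {s t u} → Star R s t → Star R s u →
              ∃[ v ] (Star R t v × Star R u v)

StronglyNormalizing : Rel → Set
StronglyNormalizing R = WellFounded (flip R)

-- Strong normalisation: every →p step strictly decreases a natural-number
-- weight.  In an explicit matching b⟨θ | μ | Δ⟩ let W be the weight of μ and
-- Δ; the matching weighs W + B plus the weight of b computed with the
-- variables of θ weighing W, since rule (r) replaces them by terms of μ.  Here
-- B is the weight of ⊥, which pays for the failing (r) steps; it is well
-- defined because ⊥ contains no explicit matching, so its own weight does not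
-- depend on B.  Every (m) step lowers W, and an application weighs one more
-- than a structural one, so (•) decreases too.
--
-- Confluence then follows from local confluence by Newman's lemma.  Shifts
-- and substitution are instances of one generic traversal, so they commute
-- with each other and preserve steps once ⊥ is closed; hence a step inside
-- the body or the decided match of a redex can be replayed after (r).  Two
-- (m) steps on different pairs of Δ commute because extending a decided match
-- at two different names commutes, and on the same pair they coincide.

module Submission where

open import Defs
open import Data.Nat
open import Data.Nat.Properties
open import Algebra.Properties.CommutativeSemigroup +-commutativeSemigroup using (x∙yz≈y∙xz; xy∙z≈xz∙y; xy∙z≈yz∙x)
open import Data.Nat.Induction using (<-wellFounded)
open import Data.Nat.Tactic.RingSolver
open import Data.Bool using (true; false; T)
open import Data.Empty using (⊥; ⊥-elim)
open import Data.Unit using (tt)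
open import Data.Fin using (Fin; toℕ; zero; suc) renaming (_≟_ to _≟F_)
open import Data.Fin.Properties using (toℕ<n; toℕ-injective)
open import Data.List using (List; []; _∷_; _++_)
open import Data.List.Properties using (++-assoc; ∷-injective)
open import Data.Maybe using (Maybe; just; nothing)
import Data.Maybe as Mb
open import Data.Vec using (Vec; []; _∷_; lookup; _[_]≔_)
import Data.Vec as V
import Data.Vec.Properties as VP
open import Data.Product using (_×_; _,_; proj₁; proj₂; Σ; ∃-syntax)
open import Data.Sum using (_⊎_; inj₁; inj₂)
open import Function using (flip)
open import Induction.WellFounded using (Acc; acc; WellFounded; module Subrelation)
import Relation.Binary.Construct.On as On
open import Relation.Binary.PropositionalEquality
open import Relation.Binary.Construct.Closure.ReflexiveTransitive using (Star; ε; _◅_; _◅◅_; gmap)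
open import Relation.Nullary using (yes; no; ¬_)

VarAction : Set
VarAction = ℕ → ℕ → ℕ → Term
MatAction : Set
MatAction = ℕ → ℕ → ℕ

mutual
  act : VarAction → MatAction → ℕ → ℕ → Term → Term
  act V M c m (var i) = V c m i
  act V M c m (mat i) = mat (M m i)
  act V M c m (app s t) = app (act V M c m s) (act V M c m t)
  act V M c m (sapp s t) = sapp (act V M c m s) (act V M c m t)
  act V M c m (abs k p b) = abs k (act V M c (k + m) p) (act V M (k + c) m b)
  act V M c m (em k b μ Δ) = em k (act V M (k + c) m b) (actμ V M c m μ) (actΔ V M k c m Δ)

  actμ : ∀ {k} → VarAction → MatAction → ℕ → ℕ → DMatch k → DMatch k
  actμ V M c m nothing = nothing
  actμ V M c m (just σ) = just (actv V M c m σ)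

  actv : ∀ {k} → VarAction → MatAction → ℕ → ℕ → Vec (Maybe Term) k → Vec (Maybe Term) k
  actv V M c m [] = []
  actv V M c m (nothing ∷ σ) = nothing ∷ actv V M c m σ
  actv V M c m (just t ∷ σ) = just (act V M c m t) ∷ actv V M c m σ

  actΔ : VarAction → MatAction → ℕ → ℕ → ℕ → List (Term × Term) → List (Term × Term)
  actΔ V M k c m [] = []
  actΔ V M k c m ((a , p) ∷ Δ) = (act V M c m a , act V M c (k + m) p) ∷ actΔ V M k c m Δ

keepVar : VarAction
keepVar c m i = var i

keepMat : MatAction
keepMat m i = i

module Fusion (V1 V2 V3 : VarAction) (M1 M2 M3 : MatAction)
  (V-fuse : ∀ c m i → act V2 M2 c m (V1 c m i) ≡ V3 c m i)
  (M-fuse : ∀ m i → M2 m (M1 m i) ≡ M3 m i) where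
  mutual
    act-fusion : ∀ t c m → act V2 M2 c m (act V1 M1 c m t) ≡ act V3 M3 c m t
    act-fusion (var i) c m = V-fuse c m i
    act-fusion (mat i) c m = cong mat (M-fuse m i)
    act-fusion (app s t) c m = cong₂ app (act-fusion s c m) (act-fusion t c m)
    act-fusion (sapp s t) c m = cong₂ sapp (act-fusion s c m) (act-fusion t c m)
    act-fusion (abs k p b) c m = cong₂ (abs k) (act-fusion p c (k + m)) (act-fusion b (k + c) m)
    act-fusion (em k b μ Δ) c m =
      cong₂ (λ x y → em k x (proj₁ y) (proj₂ y)) (act-fusion b (k + c) m)
        (cong₂ _,_ (actμ-fusion μ c m) (actΔ-fusion k Δ c m))

    actμ-fusion : ∀ {k} (μ : DMatch k) c m → actμ V2 M2 c m (actμ V1 M1 c m μ) ≡ actμ V3 M3 c m μ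
    actμ-fusion nothing c m = refl
    actμ-fusion (just σ) c m = cong just (actv-fusion σ c m)

    actv-fusion : ∀ {k} (σ : Vec (Maybe Term) k) c m → actv V2 M2 c m (actv V1 M1 c m σ) ≡ actv V3 M3 c m σ
    actv-fusion [] c m = refl
    actv-fusion (nothing ∷ σ) c m = cong (nothing ∷_) (actv-fusion σ c m)
    actv-fusion (just t ∷ σ) c m = cong₂ (λ x y → just x ∷ y) (act-fusion t c m) (actv-fusion σ c m)

    actΔ-fusion : ∀ k Δ c m → actΔ V2 M2 k c m (actΔ V1 M1 k c m Δ) ≡ actΔ V3 M3 k c m Δ
    actΔ-fusion k [] c m = refl
    actΔ-fusion k ((a , p) ∷ Δ) c m = cong₂ _∷_ (cong₂ _,_ (act-fusion a c m) (act-fusion p c (k + m))) (actΔ-fusion k Δ c m)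

act-fusion₂ : ∀ {V1 V2 V1' V2' M1 M2 M1' M2'} →
  (∀ c m i → act V2 M2 c m (V1 c m i) ≡ act V2' M2' c m (V1' c m i)) →
  (∀ m i → M2 m (M1 m i) ≡ M2' m (M1' m i)) →
  ∀ t → act V2 M2 0 0 (act V1 M1 0 0 t) ≡ act V2' M2' 0 0 (act V1' M1' 0 0 t)
act-fusion₂ {V1} {V2} {V1'} {V2'} {M1} {M2} {M1'} {M2'} agree-var agree-mat t =
  trans (Fusion.act-fusion V1 V2 V3 M1 M2 M3 agree-var agree-mat t 0 0)
        (sym (Fusion.act-fusion V1' V2' V3 M1' M2' M3 (λ _ _ _ → refl) (λ _ _ → refl) t 0 0))
  where
  V3 : VarAction
  V3 c m i = act V2' M2' c m (V1' c m i)
  M3 : MatAction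
  M3 m i = M2' m (M1' m i)

mutual
  act-id : ∀ t c m → act keepVar keepMat c m t ≡ t
  act-id (var i) c m = refl
  act-id (mat i) c m = refl
  act-id (app s t) c m = cong₂ app (act-id s c m) (act-id t c m)
  act-id (sapp s t) c m = cong₂ sapp (act-id s c m) (act-id t c m)
  act-id (abs k p b) c m = cong₂ (abs k) (act-id p c (k + m)) (act-id b (k + c) m)
  act-id (em k b μ Δ) c m = cong₂ (λ x y → em k x (proj₁ y) (proj₂ y)) (act-id b (k + c) m)
    (cong₂ _,_ (actμ-id μ c m) (actΔ-id k Δ c m))

  actμ-id : ∀ {k} (μ : DMatch k) c m → actμ keepVar keepMat c m μ ≡ μ
  actμ-id nothing c m = refl
  actμ-id (just σ) c m = cong just (actv-id σ c m)

  actv-id : ∀ {k} (σ : Vec (Maybe Term) k) c m → actv keepVar keepMat c m σ ≡ σ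
  actv-id [] c m = refl
  actv-id (nothing ∷ σ) c m = cong (nothing ∷_) (actv-id σ c m)
  actv-id (just t ∷ σ) c m = cong₂ (λ x y → just x ∷ y) (act-id t c m) (actv-id σ c m)

  actΔ-id : ∀ k Δ c m → actΔ keepVar keepMat k c m Δ ≡ Δ
  actΔ-id k [] c m = refl
  actΔ-id k ((a , p) ∷ Δ) c m = cong₂ _∷_ (cong₂ _,_ (act-id a c m) (act-id p c (k + m))) (actΔ-id k Δ c m)

module ActScoped (V : VarAction) (M : MatAction)
  (V-fixes-bound : ∀ c m i → i < c → V c m i ≡ var i)
  (M-fixes-bound : ∀ m i → i < m → M m i ≡ i) where
  mutual
    act-scoped : ∀ t {nv nm c m} → Scoped nv nm t → nv ≤ c → nm ≤ m → act V M c m t ≡ t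
    act-scoped (var i) {c = c} {m} h a b = V-fixes-bound c m i (<-≤-trans h a)
    act-scoped (mat i) {m = m} h a b = cong mat (M-fixes-bound m i (<-≤-trans h b))
    act-scoped (app s t) (h1 , h2) a b = cong₂ app (act-scoped s h1 a b) (act-scoped t h2 a b)
    act-scoped (sapp s t) (h1 , h2) a b = cong₂ sapp (act-scoped s h1 a b) (act-scoped t h2 a b)
    act-scoped (abs k p q) (h1 , h2) a b = cong₂ (abs k) (act-scoped p h1 a (+-monoʳ-≤ k b)) (act-scoped q h2 (+-monoʳ-≤ k a) b)
    act-scoped (em k q μ Δ) (h1 , h2 , h3) a b =
      cong₂ (λ x y → em k x (proj₁ y) (proj₂ y)) (act-scoped q h1 (+-monoʳ-≤ k a) b)
        (cong₂ _,_ (actμ-scoped μ h2 a b) (actΔ-scoped k Δ h3 a b))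

    actμ-scoped : ∀ {k} (μ : DMatch k) {nv nm c m} → ScopedM nv nm μ → nv ≤ c → nm ≤ m → actμ V M c m μ ≡ μ
    actμ-scoped nothing h a b = refl
    actμ-scoped (just σ) h a b = cong just (actv-scoped σ h a b)

    actv-scoped : ∀ {k} (σ : Vec (Maybe Term) k) {nv nm c m} → ScopedV nv nm σ → nv ≤ c → nm ≤ m → actv V M c m σ ≡ σ
    actv-scoped [] h a b = refl
    actv-scoped (nothing ∷ σ) h a b = cong (nothing ∷_) (actv-scoped σ h a b)
    actv-scoped (just t ∷ σ) (h1 , h2) a b = cong₂ (λ x y → just x ∷ y) (act-scoped t h1 a b) (actv-scoped σ h2 a b)

    actΔ-scoped : ∀ k Δ {nv nm c m} → ScopedΔ k nv nm Δ → nv ≤ c → nm ≤ m → actΔ V M k c m Δ ≡ Δ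
    actΔ-scoped k [] h a b = refl
    actΔ-scoped k ((x , p) ∷ Δ) (h1 , h2 , h3) a b =
      cong₂ _∷_ (cong₂ _,_ (act-scoped x h1 a b) (act-scoped p h2 a (+-monoʳ-≤ k b))) (actΔ-scoped k Δ h3 a b)

  act-closed : ∀ t → Closed t → ∀ c m → act V M c m t ≡ t
  act-closed t h c m = act-scoped t h z≤n z≤n

≤⇒¬T<ᵇ : ∀ {i c} → c ≤ i → T (i <ᵇ c) → ⊥
≤⇒¬T<ᵇ {i} {c} h t = <⇒≱ (<ᵇ⇒< i c t) h

shV-var-< : ∀ {c d i} → i < c → shV c d (var i) ≡ var i
shV-var-< {c} {d} {i} h with i <ᵇ c | <⇒<ᵇ h
... | true | _ = refl

shV-var-≥ : ∀ {c d i} → c ≤ i → shV c d (var i) ≡ var (i + d)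
shV-var-≥ {c} {d} {i} h with i <ᵇ c | ≤⇒¬T<ᵇ {i} {c} h
... | true | f = ⊥-elim (f tt)
... | false | _ = refl

shiftIdx : ℕ → ℕ → ℕ → ℕ
shiftIdx c d i with i <ᵇ c
... | true = i
... | false = i + d

shiftIdx-< : ∀ {c d i} → i < c → shiftIdx c d i ≡ i
shiftIdx-< {c} {d} {i} h with i <ᵇ c | <⇒<ᵇ h
... | true | _ = refl

shiftIdx-≥ : ∀ {c d i} → c ≤ i → shiftIdx c d i ≡ i + d
shiftIdx-≥ {c} {d} {i} h with i <ᵇ c | ≤⇒¬T<ᵇ {i} {c} h
... | true | f = ⊥-elim (f tt)
... | false | _ = refl

shiftIdx-injective : ∀ c d x y → shiftIdx c d x ≡ shiftIdx c d y → x ≡ y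
shiftIdx-injective c d x y eq with x <? c | y <? c
... | yes h1 | yes h2 = trans (sym (shiftIdx-< {c} {d} h1)) (trans eq (shiftIdx-< {c} {d} h2))
... | no h1 | no h2 = +-cancelʳ-≡ d x y (trans (sym (shiftIdx-≥ {c} {d} (≮⇒≥ h1))) (trans eq (shiftIdx-≥ {c} {d} (≮⇒≥ h2))))
... | yes h1 | no h2 = ⊥-elim (<⇒≱ h1 (≤-trans (≤-trans (≮⇒≥ h2) (m≤m+n y d))
        (≤-reflexive (sym (trans (sym (shiftIdx-< {c} {d} h1)) (trans eq (shiftIdx-≥ {c} {d} (≮⇒≥ h2))))))))
... | no h1 | yes h2 = ⊥-elim (<⇒≱ h2 (≤-trans (≤-trans (≮⇒≥ h1) (m≤m+n x d))
        (≤-reflexive (trans (sym (shiftIdx-≥ {c} {d} (≮⇒≥ h1))) (trans eq (shiftIdx-< {c} {d} h2))))))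

shiftIdx-+ : ∀ e d k m y → shiftIdx (e + (k + m)) d (k + y) ≡ k + shiftIdx (e + m) d y
shiftIdx-+ e d k m y with y <? e + m
... | yes h rewrite shiftIdx-< {e + m} {d} {y} h
                  | shiftIdx-< {e + (k + m)} {d} {k + y} (<-≤-trans (+-monoʳ-< k h) (≤-reflexive (x∙yz≈y∙xz k e m))) = refl
... | no h rewrite shiftIdx-≥ {e + m} {d} {y} (≮⇒≥ h)
                  | shiftIdx-≥ {e + (k + m)} {d} {k + y} (≤-trans (≤-reflexive (sym (x∙yz≈y∙xz k e m))) (+-monoʳ-≤ k (≮⇒≥ h)))
                  = +-assoc k y d

shM-mat : ∀ c d i → shM c d (mat i) ≡ mat (shiftIdx c d i)
shM-mat c d i with i <ᵇ c
... | true = refl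
... | false = refl

lookupℕ-< : ∀ {A : Set} {k} (σ : Vec A k) {j} → j < k → ∃[ u ] lookupℕ σ j ≡ just u
lookupℕ-< (x ∷ σ) {zero} h = x , refl
lookupℕ-< (x ∷ σ) {suc j} (s≤s h) = lookupℕ-< σ h

lookupℕ-≥ : ∀ {A : Set} {k} (σ : Vec A k) {j} → k ≤ j → lookupℕ σ j ≡ nothing
lookupℕ-≥ [] h = refl
lookupℕ-≥ (x ∷ σ) {suc j} (s≤s h) = lookupℕ-≥ σ h

lookupℕ-map : ∀ {A B : Set} {k} (f : A → B) (σ : Vec A k) j → lookupℕ (V.map f σ) j ≡ Mb.map f (lookupℕ σ j)
lookupℕ-map f [] j = refl
lookupℕ-map f (x ∷ σ) zero = refl
lookupℕ-map f (x ∷ σ) (suc j) = lookupℕ-map f σ j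

lookupℕ-nothing⇒≥ : ∀ {A : Set} {k} (σ : Vec A k) j → lookupℕ σ j ≡ nothing → k ≤ j
lookupℕ-nothing⇒≥ [] j eq = z≤n
lookupℕ-nothing⇒≥ (x ∷ σ) zero ()
lookupℕ-nothing⇒≥ (x ∷ σ) (suc j) eq = s≤s (lookupℕ-nothing⇒≥ σ j eq)

lookupℕ-just⇒< : ∀ {A : Set} {k} (σ : Vec A k) j {u} → lookupℕ σ j ≡ just u → j < k
lookupℕ-just⇒< (x ∷ σ) zero eq = s≤s z≤n
lookupℕ-just⇒< (x ∷ σ) (suc j) eq = s≤s (lookupℕ-just⇒< σ j eq)

sub-var-< : ∀ {k c m} {σ : Vec Term k} {i} → i < c → sub c m σ (var i) ≡ var i
sub-var-< {k} {c} {m} {σ} {i} h with i <ᵇ c | <⇒<ᵇ h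
... | true | _ = refl

sub-var-just : ∀ {k c m} {σ : Vec Term k} {i u} → c ≤ i → lookupℕ σ (i ∸ c) ≡ just u →
         sub c m σ (var i) ≡ shV 0 c (shM 0 m u)
sub-var-just {k} {c} {m} {σ} {i} h eq with i <ᵇ c | ≤⇒¬T<ᵇ {i} {c} h
... | true | f = ⊥-elim (f tt)
... | false | _ rewrite eq = refl

sub-var-nothing : ∀ {k c m} {σ : Vec Term k} {i} → c ≤ i → lookupℕ σ (i ∸ c) ≡ nothing →
         sub c m σ (var i) ≡ var (i ∸ k)
sub-var-nothing {k} {c} {m} {σ} {i} h eq with i <ᵇ c | ≤⇒¬T<ᵇ {i} {c} h
... | true | f = ⊥-elim (f tt)
... | false | _ rewrite eq = refl

shiftVar : ℕ → ℕ → VarAction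
shiftVar e d c m i = shV (e + c) d (var i)

shiftMat : ℕ → ℕ → MatAction
shiftMat e d m i = shiftIdx (e + m) d i

substVar : ∀ {n} → ℕ → ℕ → Vec Term n → VarAction
substVar e f σ c m i = sub (e + c) (f + m) σ (var i)

module ShVAsAct (e d : ℕ) where
  mutual
    shV-act : ∀ t c m → shV (e + c) d t ≡ act (shiftVar e d) keepMat c m t
    shV-act (var i) c m = refl
    shV-act (mat i) c m = refl
    shV-act (app s t) c m = cong₂ app (shV-act s c m) (shV-act t c m)
    shV-act (sapp s t) c m = cong₂ sapp (shV-act s c m) (shV-act t c m)
    shV-act (abs k p b) c m = cong₂ (abs k) (shV-act p c (k + m))
      (trans (cong (λ z → shV z d b) (x∙yz≈y∙xz k e c)) (shV-act b (k + c) m))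
    shV-act (em k b μ Δ) c m =
      cong₂ (λ x y → em k x (proj₁ y) (proj₂ y))
        (trans (cong (λ z → shV z d b) (x∙yz≈y∙xz k e c)) (shV-act b (k + c) m))
        (cong₂ _,_ (shVμ-act μ c m) (shVΔ-act k Δ c m))

    shVμ-act : ∀ {k} (μ : DMatch k) c m → shVμ (e + c) d μ ≡ actμ (shiftVar e d) keepMat c m μ
    shVμ-act nothing c m = refl
    shVμ-act (just σ) c m = cong just (shVv-act σ c m)

    shVv-act : ∀ {k} (σ : Vec (Maybe Term) k) c m → shVv (e + c) d σ ≡ actv (shiftVar e d) keepMat c m σ
    shVv-act [] c m = refl
    shVv-act (nothing ∷ σ) c m = cong (nothing ∷_) (shVv-act σ c m)
    shVv-act (just t ∷ σ) c m = cong₂ (λ x y → just x ∷ y) (shV-act t c m) (shVv-act σ c m)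

    shVΔ-act : ∀ k Δ c m → shVΔ (e + c) d Δ ≡ actΔ (shiftVar e d) keepMat k c m Δ
    shVΔ-act k [] c m = refl
    shVΔ-act k ((a , p) ∷ Δ) c m = cong₂ _∷_ (cong₂ _,_ (shV-act a c m) (shV-act p c (k + m))) (shVΔ-act k Δ c m)

module ShMAsAct (e d : ℕ) where
  mutual
    shM-act : ∀ t c m → shM (e + m) d t ≡ act keepVar (shiftMat e d) c m t
    shM-act (var i) c m = refl
    shM-act (mat i) c m = shM-mat (e + m) d i
    shM-act (app s t) c m = cong₂ app (shM-act s c m) (shM-act t c m)
    shM-act (sapp s t) c m = cong₂ sapp (shM-act s c m) (shM-act t c m)
    shM-act (abs k p b) c m = cong₂ (abs k)
      (trans (cong (λ z → shM z d p) (x∙yz≈y∙xz k e m)) (shM-act p c (k + m))) (shM-act b (k + c) m)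
    shM-act (em k b μ Δ) c m =
      cong₂ (λ x y → em k x (proj₁ y) (proj₂ y))
        (shM-act b (k + c) m)
        (cong₂ _,_ (shMμ-act μ c m) (shMΔ-act k Δ c m))

    shMμ-act : ∀ {k} (μ : DMatch k) c m → shMμ (e + m) d μ ≡ actμ keepVar (shiftMat e d) c m μ
    shMμ-act nothing c m = refl
    shMμ-act (just σ) c m = cong just (shMv-act σ c m)

    shMv-act : ∀ {k} (σ : Vec (Maybe Term) k) c m → shMv (e + m) d σ ≡ actv keepVar (shiftMat e d) c m σ
    shMv-act [] c m = refl
    shMv-act (nothing ∷ σ) c m = cong (nothing ∷_) (shMv-act σ c m)
    shMv-act (just t ∷ σ) c m = cong₂ (λ x y → just x ∷ y) (shM-act t c m) (shMv-act σ c m)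

    shMΔ-act : ∀ k Δ c m → shMΔ k (e + m) d Δ ≡ actΔ keepVar (shiftMat e d) k c m Δ
    shMΔ-act k [] c m = refl
    shMΔ-act k ((a , p) ∷ Δ) c m = cong₂ _∷_ (cong₂ _,_ (shM-act a c m)
      (trans (cong (λ z → shM z d p) (x∙yz≈y∙xz k e m)) (shM-act p c (k + m)))) (shMΔ-act k Δ c m)

module SubAsAct {n} (e f : ℕ) (σ : Vec Term n) where
  mutual
    sub-act : ∀ t c m → sub (e + c) (f + m) σ t ≡ act (substVar e f σ) keepMat c m t
    sub-act (var i) c m = refl
    sub-act (mat i) c m = refl
    sub-act (app s t) c m = cong₂ app (sub-act s c m) (sub-act t c m)
    sub-act (sapp s t) c m = cong₂ sapp (sub-act s c m) (sub-act t c m)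
    sub-act (abs k p b) c m = cong₂ (abs k)
      (trans (cong (λ z → sub (e + c) z σ p) (x∙yz≈y∙xz k f m)) (sub-act p c (k + m)))
      (trans (cong (λ z → sub z (f + m) σ b) (x∙yz≈y∙xz k e c)) (sub-act b (k + c) m))
    sub-act (em k b μ Δ) c m =
      cong₂ (λ x y → em k x (proj₁ y) (proj₂ y))
        (trans (cong (λ z → sub z (f + m) σ b) (x∙yz≈y∙xz k e c)) (sub-act b (k + c) m))
        (cong₂ _,_ (subμ-act μ c m) (subΔ-act k Δ c m))

    subμ-act : ∀ {k} (μ : DMatch k) c m → subμ (e + c) (f + m) σ μ ≡ actμ (substVar e f σ) keepMat c m μ
    subμ-act nothing c m = refl
    subμ-act (just τ) c m = cong just (subv-act τ c m)

    subv-act : ∀ {k} (τ : Vec (Maybe Term) k) c m → subv (e + c) (f + m) σ τ ≡ actv (substVar e f σ) keepMat c m τ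
    subv-act [] c m = refl
    subv-act (nothing ∷ τ) c m = cong (nothing ∷_) (subv-act τ c m)
    subv-act (just t ∷ τ) c m = cong₂ (λ x y → just x ∷ y) (sub-act t c m) (subv-act τ c m)

    subΔ-act : ∀ k Δ c m → subΔ k (e + c) (f + m) σ Δ ≡ actΔ (substVar e f σ) keepMat k c m Δ
    subΔ-act k [] c m = refl
    subΔ-act k ((a , p) ∷ Δ) c m = cong₂ _∷_ (cong₂ _,_ (sub-act a c m)
      (trans (cong (λ z → sub (e + c) z σ p) (x∙yz≈y∙xz k f m)) (sub-act p c (k + m)))) (subΔ-act k Δ c m)

shV-act₀ : ∀ e d t → shV e d t ≡ act (shiftVar e d) keepMat 0 0 t
shV-act₀ e d t = trans (cong (λ z → shV z d t) (sym (+-identityʳ e))) (ShVAsAct.shV-act e d t 0 0)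

shM-act₀ : ∀ e d t → shM e d t ≡ act keepVar (shiftMat e d) 0 0 t
shM-act₀ e d t = trans (cong (λ z → shM z d t) (sym (+-identityʳ e))) (ShMAsAct.shM-act e d t 0 0)

sub-act₀ : ∀ {n} e f (σ : Vec Term n) t → sub e f σ t ≡ act (substVar e f σ) keepMat 0 0 t
sub-act₀ e f σ t = trans (cong₂ (λ z w → sub z w σ t) (sym (+-identityʳ e)) (sym (+-identityʳ f)))
  (SubAsAct.sub-act e f σ t 0 0)

act-shiftVar : ∀ e d x c m → act (shiftVar e d) keepMat c m x ≡ shV (e + c) d x
act-shiftVar e d x c m = sym (ShVAsAct.shV-act e d x c m)

act-shiftMat : ∀ e d x c m → act keepVar (shiftMat e d) c m x ≡ shM (e + m) d x
act-shiftMat e d x c m = sym (ShMAsAct.shM-act e d x c m)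

act-substVar : ∀ {n} e f (σ : Vec Term n) x c' m' → act (substVar e f σ) keepMat c' m' x ≡ sub (e + c') (f + m') σ x
act-substVar e f σ x c' m' = sym (SubAsAct.sub-act e f σ x c' m')

shV-var-var : ∀ c d i → ∃[ j ] shV c d (var i) ≡ var j
shV-var-var c d i with i <ᵇ c
... | true = i , refl
... | false = i + d , refl

shV-shV₀-comm : ∀ e c d y → shV (e + c) d (shV 0 c y) ≡ shV 0 c (shV e d y)
shV-shV₀-comm e c d y =
  trans (trans (shV-act₀ (e + c) d (shV 0 c y)) (cong (act (shiftVar (e + c) d) keepMat 0 0) (shV-act₀ 0 c y)))
  (trans (act-fusion₂ {shiftVar 0 c} {shiftVar (e + c) d} {shiftVar e d} {shiftVar 0 c} {keepMat} {keepMat} {keepMat} {keepMat} on-var (λ _ _ → refl) y)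
  (sym (trans (shV-act₀ 0 c (shV e d y)) (cong (act (shiftVar 0 c) keepMat 0 0) (shV-act₀ e d y)))))
  where
  on-var : ∀ c' m' i → act (shiftVar (e + c) d) keepMat c' m' (shV c' c (var i)) ≡ act (shiftVar 0 c) keepMat c' m' (shV (e + c') d (var i))
  on-var c' m' i with i <? c'
  ... | yes h rewrite shV-var-< {c'} {c} {i} h | shV-var-< {e + c'} {d} {i} (m≤n⇒m≤o+n e h)
                    | shV-var-< {(e + c) + c'} {d} {i} (m≤n⇒m≤o+n (e + c) h) | shV-var-< {c'} {c} {i} h = refl
  ... | no h1 with i <? e + c'
  ...   | yes h2 rewrite shV-var-≥ {c'} {c} {i} (≮⇒≥ h1) | shV-var-< {e + c'} {d} {i} h2
                    | shV-var-≥ {c'} {c} {i} (≮⇒≥ h1)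
                    | shV-var-< {(e + c) + c'} {d} {i + c} (<-≤-trans (+-monoˡ-< c h2) (≤-reflexive (xy∙z≈xz∙y e c' c))) = refl
  ...   | no h3 rewrite shV-var-≥ {c'} {c} {i} (≮⇒≥ h1) | shV-var-≥ {e + c'} {d} {i} (≮⇒≥ h3)
                    | shV-var-≥ {(e + c) + c'} {d} {i + c} (≤-trans (≤-reflexive (xy∙z≈xz∙y e c c')) (+-monoˡ-≤ c (≮⇒≥ h3)))
                    | shV-var-≥ {c'} {c} {i + d} (≤-trans (≮⇒≥ h1) (m≤m+n i d)) = cong var (xy∙z≈xz∙y i c d)

shV-shM-comm : ∀ a d b f x → shV a d (shM b f x) ≡ shM b f (shV a d x)
shV-shM-comm a d b f x =
  trans (trans (shV-act₀ a d (shM b f x)) (cong (act (shiftVar a d) keepMat 0 0) (shM-act₀ b f x)))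
  (trans (act-fusion₂ {keepVar} {shiftVar a d} {shiftVar a d} {keepVar} {shiftMat b f} {keepMat} {keepMat} {shiftMat b f} on-var (λ _ _ → refl) x)
  (sym (trans (shM-act₀ b f (shV a d x)) (cong (act keepVar (shiftMat b f) 0 0) (shV-act₀ a d x)))))
  where
  on-var : ∀ c' m' i → shV (a + c') d (var i) ≡ act keepVar (shiftMat b f) c' m' (shV (a + c') d (var i))
  on-var c' m' i with shV-var-var (a + c') d i
  ... | j , eq rewrite eq = refl

shM-shM₀-comm : ∀ e m d y → shM (e + m) d (shM 0 m y) ≡ shM 0 m (shM e d y)
shM-shM₀-comm e m d y =
  trans (trans (shM-act₀ (e + m) d (shM 0 m y)) (cong (act keepVar (shiftMat (e + m) d) 0 0) (shM-act₀ 0 m y)))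
  (trans (act-fusion₂ {keepVar} {keepVar} {keepVar} {keepVar} {shiftMat 0 m} {shiftMat (e + m) d} {shiftMat e d} {shiftMat 0 m} (λ _ _ _ → refl) on-var y)
  (sym (trans (shM-act₀ 0 m (shM e d y)) (cong (act keepVar (shiftMat 0 m) 0 0) (shM-act₀ e d y)))))
  where
  on-var : ∀ m' i → shiftIdx ((e + m) + m') d (shiftIdx m' m i) ≡ shiftIdx m' m (shiftIdx (e + m') d i)
  on-var m' i with i <? m'
  ... | yes h rewrite shiftIdx-< {m'} {m} {i} h | shiftIdx-< {e + m'} {d} {i} (m≤n⇒m≤o+n e h)
                    | shiftIdx-< {(e + m) + m'} {d} {i} (m≤n⇒m≤o+n (e + m) h) | shiftIdx-< {m'} {m} {i} h = refl
  ... | no h1 with i <? e + m'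
  ...   | yes h2 rewrite shiftIdx-≥ {m'} {m} {i} (≮⇒≥ h1) | shiftIdx-< {e + m'} {d} {i} h2
                    | shiftIdx-≥ {m'} {m} {i} (≮⇒≥ h1)
                    | shiftIdx-< {(e + m) + m'} {d} {i + m} (<-≤-trans (+-monoˡ-< m h2) (≤-reflexive (xy∙z≈xz∙y e m' m))) = refl
  ...   | no h3 rewrite shiftIdx-≥ {m'} {m} {i} (≮⇒≥ h1) | shiftIdx-≥ {e + m'} {d} {i} (≮⇒≥ h3)
                    | shiftIdx-≥ {(e + m) + m'} {d} {i + m} (≤-trans (≤-reflexive (xy∙z≈xz∙y e m m')) (+-monoˡ-≤ m (≮⇒≥ h3)))
                    | shiftIdx-≥ {m'} {m} {i + d} (≤-trans (≮⇒≥ h1) (m≤m+n i d)) = xy∙z≈xz∙y i m d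

shV-shV₀-merge : ∀ a b c z → a ≤ b → shV a c (shV 0 b z) ≡ shV 0 (b + c) z
shV-shV₀-merge a b c z ab =
  trans (trans (shV-act₀ a c (shV 0 b z)) (cong (act (shiftVar a c) keepMat 0 0) (shV-act₀ 0 b z)))
  (trans (Fusion.act-fusion (shiftVar 0 b) (shiftVar a c) (shiftVar 0 (b + c)) keepMat keepMat keepMat on-var (λ _ _ → refl) z 0 0)
  (sym (shV-act₀ 0 (b + c) z)))
  where
  on-var : ∀ c' m' i → act (shiftVar a c) keepMat c' m' (shV c' b (var i)) ≡ shV c' (b + c) (var i)
  on-var c' m' i with i <? c'
  ... | yes h rewrite shV-var-< {c'} {b} {i} h | shV-var-< {a + c'} {c} {i} (m≤n⇒m≤o+n a h)
                    | shV-var-< {c'} {b + c} {i} h = refl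
  ... | no h rewrite shV-var-≥ {c'} {b} {i} (≮⇒≥ h) | shV-var-≥ {c'} {b + c} {i} (≮⇒≥ h)
                    | shV-var-≥ {a + c'} {c} {i + b} (≤-trans (+-monoˡ-≤ c' ab) (≤-trans (≤-reflexive (+-comm b c')) (+-monoˡ-≤ b (≮⇒≥ h))))
                    = cong var (+-assoc i b c)

shM-shM₀-merge : ∀ a b c z → a ≤ b → shM a c (shM 0 b z) ≡ shM 0 (b + c) z
shM-shM₀-merge a b c z ab =
  trans (trans (shM-act₀ a c (shM 0 b z)) (cong (act keepVar (shiftMat a c) 0 0) (shM-act₀ 0 b z)))
  (trans (Fusion.act-fusion keepVar keepVar keepVar (shiftMat 0 b) (shiftMat a c) (shiftMat 0 (b + c)) (λ _ _ _ → refl) on-var z 0 0)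
  (sym (shM-act₀ 0 (b + c) z)))
  where
  on-var : ∀ m' i → shiftIdx (a + m') c (shiftIdx m' b i) ≡ shiftIdx m' (b + c) i
  on-var m' i with i <? m'
  ... | yes h rewrite shiftIdx-< {m'} {b} {i} h | shiftIdx-< {a + m'} {c} {i} (m≤n⇒m≤o+n a h)
                    | shiftIdx-< {m'} {b + c} {i} h = refl
  ... | no h rewrite shiftIdx-≥ {m'} {b} {i} (≮⇒≥ h) | shiftIdx-≥ {m'} {b + c} {i} (≮⇒≥ h)
                    | shiftIdx-≥ {a + m'} {c} {i + b} (≤-trans (+-monoˡ-≤ m' ab) (≤-trans (≤-reflexive (+-comm b m')) (+-monoˡ-≤ b (≮⇒≥ h))))
                    = +-assoc i b c

sub-shV-cancel : ∀ {k} c m (τ : Vec Term k) x → sub c m τ (shV c k x) ≡ x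
sub-shV-cancel {k} c m τ x =
  trans (trans (sub-act₀ c m τ (shV c k x)) (cong (act (substVar c m τ) keepMat 0 0) (shV-act₀ c k x)))
  (trans (Fusion.act-fusion (shiftVar c k) (substVar c m τ) keepVar keepMat keepMat keepMat on-var (λ _ _ → refl) x 0 0) (act-id x 0 0))
  where
  on-var : ∀ c' m' i → act (substVar c m τ) keepMat c' m' (shV (c + c') k (var i)) ≡ var i
  on-var c' m' i with i <? c + c'
  ... | yes h rewrite shV-var-< {c + c'} {k} {i} h = sub-var-< h
  ... | no h rewrite shV-var-≥ {c + c'} {k} {i} (≮⇒≥ h) =
    trans (sub-var-nothing {σ = τ} (≤-trans (≮⇒≥ h) (m≤m+n i k))
      (lookupℕ-≥ τ (≤-trans (m≤n+m k (i ∸ (c + c'))) (≤-reflexive (sym (+-∸-comm k (≮⇒≥ h)))))))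
      (cong var (m+n∸n≡m i k))

[m+n]∸[o+n+p]≡m∸[o+p] : ∀ i c e c' → (i + c) ∸ ((e + c) + c') ≡ i ∸ (e + c')
[m+n]∸[o+n+p]≡m∸[o+p] i c e c' = trans (cong₂ _∸_ (+-comm i c) (trans (xy∙z≈xz∙y e c c') (+-comm (e + c') c)))
                     ([m+n]∸[m+o]≡n∸o c i (e + c'))

o≤m∸n⇒p≤n⇒p≤m∸o : ∀ i n a c' → n ≤ i ∸ a → c' ≤ a → a ≤ i → c' ≤ i ∸ n
o≤m∸n⇒p≤n⇒p≤m∸o i n a c' h1 h2 h3 = ≤-trans h2 (≤-trans (m+n≤o⇒m≤o∸n a {n} (≤-trans (≤-reflexive (+-comm a n))
  (≤-trans (+-monoˡ-≤ a h1) (≤-reflexive (m∸n+n≡m h3))))) ≤-refl)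

sub-shV₀-comm : ∀ {n} e c g (σ : Vec Term n) y → sub (e + c) g σ (shV 0 c y) ≡ shV 0 c (sub e g σ y)
sub-shV₀-comm {n} e c g σ y =
  trans (trans (sub-act₀ (e + c) g σ (shV 0 c y)) (cong (act (substVar (e + c) g σ) keepMat 0 0) (shV-act₀ 0 c y)))
  (trans (act-fusion₂ {shiftVar 0 c} {substVar (e + c) g σ} {substVar e g σ} {shiftVar 0 c} {keepMat} {keepMat} {keepMat} {keepMat} on-var (λ _ _ → refl) y)
  (sym (trans (shV-act₀ 0 c (sub e g σ y)) (cong (act (shiftVar 0 c) keepMat 0 0) (sub-act₀ e g σ y)))))
  where
  on-var : ∀ c' m' i → act (substVar (e + c) g σ) keepMat c' m' (shV c' c (var i))
                 ≡ act (shiftVar 0 c) keepMat c' m' (sub (e + c') (g + m') σ (var i))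
  on-var c' m' i with i <? c'
  ... | yes h rewrite shV-var-< {c'} {c} {i} h | sub-var-< {n} {e + c'} {g + m'} {σ} {i} (m≤n⇒m≤o+n e h)
                    | sub-var-< {n} {(e + c) + c'} {g + m'} {σ} {i} (m≤n⇒m≤o+n (e + c) h) | shV-var-< {c'} {c} {i} h = refl
  ... | no h1 with i <? e + c'
  ...   | yes h2 rewrite shV-var-≥ {c'} {c} {i} (≮⇒≥ h1) | sub-var-< {n} {e + c'} {g + m'} {σ} {i} h2
                    | shV-var-≥ {c'} {c} {i} (≮⇒≥ h1)
                    | sub-var-< {n} {(e + c) + c'} {g + m'} {σ} {i + c} (<-≤-trans (+-monoˡ-< c h2) (≤-reflexive (xy∙z≈xz∙y e c' c))) = refl
  ...   | no h3 with lookupℕ σ (i ∸ (e + c')) in eq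
  ...     | just v rewrite shV-var-≥ {c'} {c} {i} (≮⇒≥ h1)
                   | sub-var-just {n} {e + c'} {g + m'} {σ} {i} (≮⇒≥ h3) eq
                   | sub-var-just {n} {(e + c) + c'} {g + m'} {σ} {i + c} {v}
                       (≤-trans (≤-reflexive (xy∙z≈xz∙y e c c')) (+-monoˡ-≤ c (≮⇒≥ h3)))
                       (trans (cong (lookupℕ σ) ([m+n]∸[o+n+p]≡m∸[o+p] i c e c')) eq)
                   = sym (trans (act-shiftVar 0 c (shV 0 (e + c') (shM 0 (g + m') v)) c' m')
                       (trans (shV-shV₀-merge c' (e + c') c (shM 0 (g + m') v) (m≤n⇒m≤o+n e ≤-refl))
                              (cong (λ z → shV 0 z (shM 0 (g + m') v)) (xy∙z≈xz∙y e c' c))))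
  ...     | nothing rewrite shV-var-≥ {c'} {c} {i} (≮⇒≥ h1)
                   | sub-var-nothing {n} {e + c'} {g + m'} {σ} {i} (≮⇒≥ h3) eq
                   | sub-var-nothing {n} {(e + c) + c'} {g + m'} {σ} {i + c}
                       (≤-trans (≤-reflexive (xy∙z≈xz∙y e c c')) (+-monoˡ-≤ c (≮⇒≥ h3)))
                       (trans (cong (lookupℕ σ) ([m+n]∸[o+n+p]≡m∸[o+p] i c e c')) eq)
                   | shV-var-≥ {c'} {c} {i ∸ n} (o≤m∸n⇒p≤n⇒p≤m∸o i n (e + c') c' (lookupℕ-nothing⇒≥ σ _ eq) (m≤n⇒m≤o+n e ≤-refl) (≮⇒≥ h3))
                   = cong var (+-∸-comm c (≤-trans (lookupℕ-nothing⇒≥ σ _ eq) (m∸n≤m i (e + c'))))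

sub-shM₀-comm : ∀ {n} e f m (σ : Vec Term n) u → sub e (f + m) σ (shM 0 m u) ≡ shM 0 m (sub e f σ u)
sub-shM₀-comm {n} e f m σ u =
  trans (trans (sub-act₀ e (f + m) σ (shM 0 m u)) (cong (act (substVar e (f + m) σ) keepMat 0 0) (shM-act₀ 0 m u)))
  (trans (act-fusion₂ {keepVar} {substVar e (f + m) σ} {substVar e f σ} {keepVar} {shiftMat 0 m} {keepMat} {keepMat} {shiftMat 0 m} on-var (λ _ _ → refl) u)
  (sym (trans (shM-act₀ 0 m (sub e f σ u)) (cong (act keepVar (shiftMat 0 m) 0 0) (sub-act₀ e f σ u)))))
  where
  on-var : ∀ c' m' i → sub (e + c') ((f + m) + m') σ (var i)
                 ≡ act keepVar (shiftMat 0 m) c' m' (sub (e + c') (f + m') σ (var i))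
  on-var c' m' i with i <? e + c'
  ... | yes h rewrite sub-var-< {n} {e + c'} {(f + m) + m'} {σ} {i} h | sub-var-< {n} {e + c'} {f + m'} {σ} {i} h = refl
  ... | no h with lookupℕ σ (i ∸ (e + c')) in eq
  ...   | just v rewrite sub-var-just {n} {e + c'} {(f + m) + m'} {σ} {i} (≮⇒≥ h) eq
                       | sub-var-just {n} {e + c'} {f + m'} {σ} {i} (≮⇒≥ h) eq =
    sym (trans (act-shiftMat 0 m (shV 0 (e + c') (shM 0 (f + m') v)) c' m')
        (trans (sym (shV-shM-comm 0 (e + c') m' m (shM 0 (f + m') v)))
        (cong (shV 0 (e + c')) (trans (shM-shM₀-merge m' (f + m') m v (m≤n+m m' f))
           (cong (λ z → shM 0 z v) (sym (xy∙z≈xz∙y f m m')))))))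
  ...   | nothing rewrite sub-var-nothing {n} {e + c'} {(f + m) + m'} {σ} {i} (≮⇒≥ h) eq
                        | sub-var-nothing {n} {e + c'} {f + m'} {σ} {i} (≮⇒≥ h) eq = refl

m∸n<o⇒m<o+p+n : ∀ {c i k} e → c ≤ i → i ∸ c < k → i < (k + e) + c
m∸n<o⇒m<o+p+n {c} {i} {k} e h h2 = subst (_< (k + e) + c) (m∸n+n≡m h)
  (<-≤-trans (+-monoˡ-< c h2) (+-monoˡ-≤ c (m≤m+n k e)))

m<n+o+p⇒m∸n<o+p : ∀ {i k e c} → i < (k + e) + c → k ≤ i → i ∸ k < e + c
m<n+o+p⇒m∸n<o+p {i} {k} {e} {c} h h2 = subst (i ∸ k <_) (trans (cong (_∸ k) (+-assoc k e c)) (m+n∸m≡n k (e + c)))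
  (∸-monoˡ-< h h2)

n+o+p≤m⇒o+p≤m∸n : ∀ {i k e c} → (k + e) + c ≤ i → e + c ≤ i ∸ k
n+o+p≤m⇒o+p≤m∸n {i} {k} {e} {c} h = m+n≤o⇒m≤o∸n (e + c) (≤-trans (≤-reflexive (trans (+-comm (e + c) k) (sym (+-assoc k e c)))) h)

o≤m∸n⇒o≤m+p∸n : ∀ {i c k} d → c ≤ i → k ≤ i ∸ c → k ≤ (i + d) ∸ c
o≤m∸n⇒o≤m+p∸n {i} {c} {k} d h h2 = ≤-trans h2 (≤-trans (m≤m+n (i ∸ c) d) (≤-reflexive (sym (+-∸-comm d h))))

shV-substTop : ∀ e d {k} (τ : Vec Term k) b → shV e d (substTop τ b) ≡ substTop (V.map (shV e d) τ) (shV (k + e) d b)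
shV-substTop e d {k} τ b =
  trans (trans (shV-act₀ e d (sub 0 0 τ b)) (cong (act (shiftVar e d) keepMat 0 0) (sub-act₀ 0 0 τ b)))
  (trans (act-fusion₂ {substVar 0 0 τ} {shiftVar e d} {shiftVar (k + e) d} {substVar 0 0 τ'} {keepMat} {keepMat} {keepMat} {keepMat} on-var (λ _ _ → refl) b)
  (sym (trans (sub-act₀ 0 0 τ' (shV (k + e) d b)) (cong (act (substVar 0 0 τ') keepMat 0 0) (shV-act₀ (k + e) d b)))))
  where
  τ' : Vec Term k
  τ' = V.map (shV e d) τ
  on-var : ∀ c m i → act (shiftVar e d) keepMat c m (sub c m τ (var i)) ≡ act (substVar 0 0 τ') keepMat c m (shV ((k + e) + c) d (var i))
  on-var c m i with i <? c
  ... | yes h rewrite sub-var-< {k} {c} {m} {τ} {i} h | shV-var-< {(k + e) + c} {d} {i} (m≤n⇒m≤o+n (k + e) h)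
                    | shV-var-< {e + c} {d} {i} (m≤n⇒m≤o+n e h) | sub-var-< {k} {c} {m} {τ'} {i} h = refl
  ... | no h with lookupℕ τ (i ∸ c) in eq
  ...   | just u rewrite sub-var-just {k} {c} {m} {τ} {i} (≮⇒≥ h) eq
                       | shV-var-< {(k + e) + c} {d} {i} (m∸n<o⇒m<o+p+n e (≮⇒≥ h) (lookupℕ-just⇒< τ _ eq))
                       | sub-var-just {k} {c} {m} {τ'} {i} {shV e d u} (≮⇒≥ h) (trans (lookupℕ-map (shV e d) τ (i ∸ c)) (cong (Mb.map (shV e d)) eq))
                       = trans (act-shiftVar e d (shV 0 c (shM 0 m u)) c m) (trans (shV-shV₀-comm e c d (shM 0 m u)) (cong (shV 0 c) (shV-shM-comm e d 0 m u)))
  ...   | nothing with i <? (k + e) + c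
  ...     | yes h2 rewrite sub-var-nothing {k} {c} {m} {τ} {i} (≮⇒≥ h) eq
                       | shV-var-< {(k + e) + c} {d} {i} h2
                       | sub-var-nothing {k} {c} {m} {τ'} {i} (≮⇒≥ h) (trans (lookupℕ-map (shV e d) τ (i ∸ c)) (cong (Mb.map (shV e d)) eq))
                       | shV-var-< {e + c} {d} {i ∸ k} (m<n+o+p⇒m∸n<o+p {i} {k} {e} {c} h2 (≤-trans (lookupℕ-nothing⇒≥ τ _ eq) (m∸n≤m i c)))
                       = refl
  ...     | no h2 rewrite sub-var-nothing {k} {c} {m} {τ} {i} (≮⇒≥ h) eq
                       | shV-var-≥ {(k + e) + c} {d} {i} (≮⇒≥ h2)
                       | sub-var-nothing {k} {c} {m} {τ'} {i + d} (≤-trans (≮⇒≥ h) (m≤m+n i d))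
                           (lookupℕ-≥ τ' (o≤m∸n⇒o≤m+p∸n d (≮⇒≥ h) (lookupℕ-nothing⇒≥ τ _ eq)))
                       | shV-var-≥ {e + c} {d} {i ∸ k} (n+o+p≤m⇒o+p≤m∸n {i} {k} {e} {c} (≮⇒≥ h2))
                       = cong var (sym (+-∸-comm d (≤-trans (lookupℕ-nothing⇒≥ τ _ eq) (m∸n≤m i c))))

shM-substTop : ∀ e d {k} (τ : Vec Term k) b → shM e d (substTop τ b) ≡ substTop (V.map (shM e d) τ) (shM e d b)
shM-substTop e d {k} τ b =
  trans (trans (shM-act₀ e d (sub 0 0 τ b)) (cong (act keepVar (shiftMat e d) 0 0) (sub-act₀ 0 0 τ b)))
  (trans (act-fusion₂ {substVar 0 0 τ} {keepVar} {keepVar} {substVar 0 0 τ'} {keepMat} {shiftMat e d} {shiftMat e d} {keepMat} on-var (λ _ _ → refl) b)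
  (sym (trans (sub-act₀ 0 0 τ' (shM e d b)) (cong (act (substVar 0 0 τ') keepMat 0 0) (shM-act₀ e d b)))))
  where
  τ' : Vec Term k
  τ' = V.map (shM e d) τ
  on-var : ∀ c m i → act keepVar (shiftMat e d) c m (sub c m τ (var i)) ≡ sub c m τ' (var i)
  on-var c m i with i <? c
  ... | yes h rewrite sub-var-< {k} {c} {m} {τ} {i} h | sub-var-< {k} {c} {m} {τ'} {i} h = refl
  ... | no h with lookupℕ τ (i ∸ c) in eq
  ...   | just u rewrite sub-var-just {k} {c} {m} {τ} {i} (≮⇒≥ h) eq
                       | sub-var-just {k} {c} {m} {τ'} {i} {shM e d u} (≮⇒≥ h) (trans (lookupℕ-map (shM e d) τ (i ∸ c)) (cong (Mb.map (shM e d)) eq))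
                       = trans (act-shiftMat e d (shV 0 c (shM 0 m u)) c m)
                           (trans (sym (shV-shM-comm 0 c (e + m) d (shM 0 m u))) (cong (shV 0 c) (shM-shM₀-comm e m d u)))
  ...   | nothing rewrite sub-var-nothing {k} {c} {m} {τ} {i} (≮⇒≥ h) eq
                       | sub-var-nothing {k} {c} {m} {τ'} {i} (≮⇒≥ h) (trans (lookupℕ-map (shM e d) τ (i ∸ c)) (cong (Mb.map (shM e d)) eq))
                       = refl

module _ {n} (e f : ℕ) (σ : Vec Term n) {k} (τ : Vec Term k) where
  private
    τ' : Vec Term k
    τ' = V.map (sub e f σ) τ

    lookup-τ' : ∀ j → lookupℕ τ' j ≡ Mb.map (sub e f σ) (lookupℕ τ j)
    lookup-τ' j = lookupℕ-map (sub e f σ) τ j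
    index-beyond-σ : ∀ {i j c} → (k + e) + c ≤ i → j ≤ i ∸ ((k + e) + c) → c ≤ i ∸ j × k ≤ (i ∸ j) ∸ c
    index-beyond-σ {i} {j} {c} h1 h2 =
      ≤-trans (m≤n+m c (k + e)) kec≤ , m+n≤o⇒m≤o∸n k (≤-trans (+-monoˡ-≤ c (m≤m+n k e)) kec≤)
      where
      kec≤ : (k + e) + c ≤ i ∸ j
      kec≤ = m+n≤o⇒m≤o∸n ((k + e) + c) (≤-trans (≤-reflexive (+-comm _ j)) (m≤o∸n⇒m+n≤o j h1 h2))

  sub-substTop-var : ∀ c m i →
    act (substVar e f σ) keepMat c m (sub c m τ (var i))
      ≡ act (substVar 0 0 (V.map (sub e f σ) τ)) keepMat c m (sub ((k + e) + c) (f + m) σ (var i))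
  sub-substTop-var c m i with i <? c
  ... | yes h rewrite sub-var-< {k} {c} {m} {τ} {i} h | sub-var-< {n} {(k + e) + c} {f + m} {σ} {i} (m≤n⇒m≤o+n (k + e) h)
                    | sub-var-< {n} {e + c} {f + m} {σ} {i} (m≤n⇒m≤o+n e h) | sub-var-< {k} {c} {m} {τ'} {i} h = refl
  ... | no h with lookupℕ τ (i ∸ c) in eq
  ...   | just u rewrite sub-var-just {k} {c} {m} {τ} {i} (≮⇒≥ h) eq
                       | sub-var-< {n} {(k + e) + c} {f + m} {σ} {i} (m∸n<o⇒m<o+p+n e (≮⇒≥ h) (lookupℕ-just⇒< τ _ eq))
                       | sub-var-just {k} {c} {m} {τ'} {i} {sub e f σ u} (≮⇒≥ h) (trans (lookup-τ' (i ∸ c)) (cong (Mb.map (sub e f σ)) eq))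
                       = trans (act-substVar e f σ (shV 0 c (shM 0 m u)) c m)
                           (trans (sub-shV₀-comm e c (f + m) σ (shM 0 m u)) (cong (shV 0 c) (sub-shM₀-comm e f m σ u)))
  ...   | nothing with i <? (k + e) + c
  ...     | yes h2 rewrite sub-var-nothing {k} {c} {m} {τ} {i} (≮⇒≥ h) eq
                       | sub-var-< {n} {(k + e) + c} {f + m} {σ} {i} h2
                       | sub-var-nothing {k} {c} {m} {τ'} {i} (≮⇒≥ h) (trans (lookup-τ' (i ∸ c)) (cong (Mb.map (sub e f σ)) eq))
                       | sub-var-< {n} {e + c} {f + m} {σ} {i ∸ k} (m<n+o+p⇒m∸n<o+p {i} {k} {e} {c} h2 (≤-trans (lookupℕ-nothing⇒≥ τ _ eq) (m∸n≤m i c)))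
                       = refl
  ...     | no h2 with lookupℕ σ (i ∸ ((k + e) + c)) in eq2
  ...       | just v rewrite sub-var-nothing {k} {c} {m} {τ} {i} (≮⇒≥ h) eq
                       | sub-var-just {n} {(k + e) + c} {f + m} {σ} {i} (≮⇒≥ h2) eq2
                       | sub-var-just {n} {e + c} {f + m} {σ} {i ∸ k} {v} (n+o+p≤m⇒o+p≤m∸n {i} {k} {e} {c} (≮⇒≥ h2))
                           (trans (cong (lookupℕ σ) (trans (∸-+-assoc i k (e + c)) (cong (i ∸_) (sym (+-assoc k e c))))) eq2)
                       = sym (trans (act-substVar 0 0 τ' (shV 0 ((k + e) + c) (shM 0 (f + m) v)) c m)
                           (trans (cong (λ z → sub c m τ' (shV 0 z (shM 0 (f + m) v))) (xy∙z≈yz∙x k e c))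
                           (trans (cong (sub c m τ') (sym (shV-shV₀-merge c (e + c) k (shM 0 (f + m) v) (m≤n+m c e))))
                                  (sub-shV-cancel c m τ' (shV 0 (e + c) (shM 0 (f + m) v))))))
  ...       | nothing rewrite sub-var-nothing {k} {c} {m} {τ} {i} (≮⇒≥ h) eq
                       | sub-var-nothing {n} {(k + e) + c} {f + m} {σ} {i} (≮⇒≥ h2) eq2
                       | sub-var-nothing {n} {e + c} {f + m} {σ} {i ∸ k} (n+o+p≤m⇒o+p≤m∸n {i} {k} {e} {c} (≮⇒≥ h2))
                           (trans (cong (lookupℕ σ) (trans (∸-+-assoc i k (e + c)) (cong (i ∸_) (sym (+-assoc k e c))))) eq2)
                       | sub-var-nothing {k} {c} {m} {τ'} {i ∸ n} (proj₁ (index-beyond-σ (≮⇒≥ h2) (lookupℕ-nothing⇒≥ σ _ eq2)))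
                           (lookupℕ-≥ τ' (proj₂ (index-beyond-σ (≮⇒≥ h2) (lookupℕ-nothing⇒≥ σ _ eq2))))
                       = cong var (trans (∸-+-assoc i k n) (trans (cong (i ∸_) (+-comm k n)) (sym (∸-+-assoc i n k))))

  sub-substTop : ∀ b → sub e f σ (substTop τ b) ≡ substTop (V.map (sub e f σ) τ) (sub (k + e) f σ b)
  sub-substTop b =
    trans (trans (sub-act₀ e f σ (sub 0 0 τ b)) (cong (act (substVar e f σ) keepMat 0 0) (sub-act₀ 0 0 τ b)))
    (trans (act-fusion₂ {substVar 0 0 τ} {substVar e f σ} {substVar (k + e) f σ} {substVar 0 0 τ'} {keepMat} {keepMat} {keepMat} {keepMat} sub-substTop-var (λ _ _ → refl) b)
    (sym (trans (sub-act₀ 0 0 τ' (sub (k + e) f σ b)) (cong (act (substVar 0 0 τ') keepMat 0 0) (sub-act₀ (k + e) f σ b)))))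

Step-resp-≡ : ∀ {R s s' t t'} → s ≡ s' → t ≡ t' → Step R s t → Step R s' t'
Step-resp-≡ refl refl st = st

actΔ-++ : ∀ V M k c m Δ1 Δ2 → actΔ V M k c m (Δ1 ++ Δ2) ≡ actΔ V M k c m Δ1 ++ actΔ V M k c m Δ2
actΔ-++ V M k c m [] Δ2 = refl
actΔ-++ V M k c m ((a , p) ∷ Δ1) Δ2 = cong (_ ∷_) (actΔ-++ V M k c m Δ1 Δ2)

lookup-actv : ∀ V M c m {k} (σ : Vec (Maybe Term) k) x → lookup (actv V M c m σ) x ≡ Mb.map (act V M c m) (lookup σ x)
lookup-actv V M c m (nothing ∷ σ) zero = refl
lookup-actv V M c m (just t ∷ σ) zero = refl
lookup-actv V M c m (nothing ∷ σ) (suc x) = lookup-actv V M c m σ x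
lookup-actv V M c m (just t ∷ σ) (suc x) = lookup-actv V M c m σ x

actv-update : ∀ V M c m {k} (σ : Vec (Maybe Term) k) x a →
  actv V M c m (σ [ x ]≔ just a) ≡ actv V M c m σ [ x ]≔ just (act V M c m a)
actv-update V M c m (nothing ∷ σ) zero a = refl
actv-update V M c m (just t ∷ σ) zero a = refl
actv-update V M c m (nothing ∷ σ) (suc x) a = cong (nothing ∷_) (actv-update V M c m σ x a)
actv-update V M c m (just t ∷ σ) (suc x) a = cong (_ ∷_) (actv-update V M c m σ x a)

actμ-extend : ∀ V M c m {k} (μ : DMatch k) x a → actμ V M c m (extend μ x a) ≡ extend (actμ V M c m μ) x (act V M c m a)
actμ-extend V M c m nothing x a = refl
actμ-extend V M c m (just σ) x a with lookup σ x in eq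
... | just u rewrite lookup-actv V M c m σ x | eq = refl
... | nothing rewrite lookup-actv V M c m σ x | eq = cong just (actv-update V M c m σ x a)

allJust-actv : ∀ V M c m {k} (σ : Vec (Maybe Term) k) {τ} → allJust σ ≡ just τ →
  allJust (actv V M c m σ) ≡ just (V.map (act V M c m) τ)
allJust-actv V M c m [] refl = refl
allJust-actv V M c m (nothing ∷ σ) ()
allJust-actv V M c m (just t ∷ σ) eq with allJust σ in e1
allJust-actv V M c m (just t ∷ σ) refl | just τ rewrite allJust-actv V M c m σ e1 = refl

allJust-actv-nothing : ∀ V M c m {k} (σ : Vec (Maybe Term) k) → allJust σ ≡ nothing →
  allJust (actv V M c m σ) ≡ nothing
allJust-actv-nothing V M c m (nothing ∷ σ) eq = refl
allJust-actv-nothing V M c m (just t ∷ σ) eq with allJust σ in e1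
allJust-actv-nothing V M c m (just t ∷ σ) refl | nothing rewrite allJust-actv-nothing V M c m σ e1 = refl

-- M must leave the matchables bound by θ alone and commute with entering θ,
-- so that (m) redexes and their failure side conditions are preserved.
module ActStep (bot : Term) (V : VarAction) (M : MatAction)
  (M-fixes-bound : ∀ m i → i < m → M m i ≡ i)
  (M-+ : ∀ k m y → M (k + m) (k + y) ≡ k + M m y)
  (M-injective : ∀ m x y → M m x ≡ M m y → x ≡ y)
  (act-substTop : ∀ c m k (τ : Vec Term k) b → act V M c m (substTop τ b) ≡ substTop (V.map (act V M c m) τ) (act V M (k + c) m b))
  (act-bot : ∀ c m → act V M c m bot ≡ bot) where

  R : Term → Term → Set
  R = PRoot bot

  decomp : ∀ k x → k ≤ x → x ≡ k + (x ∸ k)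
  decomp k x h = sym (m+[n∸m]≡n h)

  M-≥ : ∀ k m x → k ≤ x → k ≤ M (k + m) x
  M-≥ k m x h = subst (k ≤_) (trans (sym (M-+ k m (x ∸ k))) (cong (M (k + m)) (sym (decomp k x h)))) (m≤m+n k _)

  Fails-act : ∀ {k a p} c m → Fails k a p → Fails k (act V M c m a) (act V M c (k + m) p)
  Fails-act {k} c m (mat-mat {x} {y} h ne) = mat-mat (M-≥ k m x h) ne'
    where
    ne' : M (k + m) x ≢ k + M m y
    ne' eq = ne (trans (decomp k x h) (cong (k +_) (M-injective m _ _ (+-cancelˡ-≡ k _ _ eq'))))
      where
      eq' : k + M m (x ∸ k) ≡ k + M m y
      eq' = trans (sym (M-+ k m (x ∸ k))) (trans (cong (M (k + m)) (sym (decomp k x h))) eq)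
  Fails-act {k} c m (sapp-mat {x = x} h) = sapp-mat (M-≥ k m x h)
  Fails-act {k} c m (abs-mat {x = x} h) = abs-mat (M-≥ k m x h)
  Fails-act c m mat-sapp = mat-sapp
  Fails-act c m abs-sapp = abs-sapp
  Fails-act c m any-abs = any-abs

  act-root : ∀ {s t} c m → R s t → Step R (act V M c m s) (act V M c m t)
  act-root c m bullet-mat = root bullet-mat
  act-root c m bullet-sapp = root bullet-sapp
  act-root c m (m-bind {k} {b} {μ} {Δ₁} {Δ₂} {a} x) =
    Step-resp-≡ (cong (em k _ _) (sym (trans (actΔ-++ V M k c m Δ₁ _)
              (cong (λ z → actΔ V M k c m Δ₁ ++ (act V M c m a , mat z) ∷ actΔ V M k c m Δ₂)
                    (M-fixes-bound (k + m) (toℕ x) (<-≤-trans (toℕ<n x) (m≤m+n k m)))))))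
          (cong₂ (em k _) (sym (actμ-extend V M c m μ x a)) (sym (actΔ-++ V M k c m Δ₁ Δ₂)))
          (root (m-bind x))
  act-root c m (m-same {k} {b} {μ} {Δ₁} {Δ₂} {y}) =
    Step-resp-≡ (cong (em k _ _) (sym (trans (actΔ-++ V M k c m Δ₁ _)
              (cong (λ z → actΔ V M k c m Δ₁ ++ (mat (M m y) , mat z) ∷ actΔ V M k c m Δ₂) (M-+ k m y)))))
          (cong (em k _ _) (sym (actΔ-++ V M k c m Δ₁ Δ₂)))
          (root m-same)
  act-root c m (m-decomp {k} {b} {μ} {Δ₁} {Δ₂}) =
    Step-resp-≡ (cong (em k _ _) (sym (actΔ-++ V M k c m Δ₁ _)))
          (cong (em k _ _) (sym (actΔ-++ V M k c m Δ₁ _)))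
          (root m-decomp)
  act-root c m (m-fail {k} {b} {μ} {Δ₁} {Δ₂} f) =
    Step-resp-≡ (cong (em k _ _) (sym (actΔ-++ V M k c m Δ₁ _)))
          (cong (em k _ _) (sym (actΔ-++ V M k c m Δ₁ Δ₂)))
          (root (m-fail (Fails-act c m f)))
  act-root c m (r-subst {k} {b} {σ} {τ} eq) =
    Step-resp-≡ refl (sym (act-substTop c m k τ b)) (root (r-subst (allJust-actv V M c m σ eq)))
  act-root c m (r-dom {k} {b} {σ} eq) =
    Step-resp-≡ refl (sym (act-bot c m)) (root (r-dom (allJust-actv-nothing V M c m σ eq)))
  act-root c m r-fail = Step-resp-≡ refl (sym (act-bot c m)) (root r-fail)

  mutual
    act-step : ∀ {s t} c m → Step R s t → Step R (act V M c m s) (act V M c m t)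
    act-step c m (root r) = act-root c m r
    act-step c m (appL st) = appL (act-step c m st)
    act-step c m (appR st) = appR (act-step c m st)
    act-step c m (sappL st) = sappL (act-step c m st)
    act-step c m (sappR st) = sappR (act-step c m st)
    act-step c m (absP {k} st) = absP (act-step c (k + m) st)
    act-step c m (absB {k} st) = absB (act-step (k + c) m st)
    act-step c m (emB {k} st) = emB (act-step (k + c) m st)
    act-step c m (emμ st) = emμ (actv-step c m st)
    act-step c m (emΔ {k} st) = emΔ (actΔ-step k c m st)

    actv-step : ∀ {k} {σ σ' : Vec (Maybe Term) k} c m → StepV R σ σ' → StepV R (actv V M c m σ) (actv V M c m σ')
    actv-step c m (here st) = here (act-step c m st)
    actv-step c m (there {x = nothing} st) = there (actv-step c m st)
    actv-step c m (there {x = just t} st) = there (actv-step c m st)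

    actΔ-step : ∀ k {Δ Δ'} c m → StepΔ R Δ Δ' → StepΔ R (actΔ V M k c m Δ) (actΔ V M k c m Δ')
    actΔ-step k c m (fstS st) = fstS (act-step c m st)
    actΔ-step k c m (sndS st) = sndS (act-step c (k + m) st)
    actΔ-step k c m (there {x = (a , p)} st) = there (actΔ-step k c m st)

module _ (bot : Term) (cl : Closed bot) where
  private
    R : Term → Term → Set
    R = PRoot bot

  shV-step : ∀ e d {s t} → Step R s t → Step R (shV e d s) (shV e d t)
  shV-step e d {s} {t} st = Step-resp-≡ (sym (shV-act₀ e d s)) (sym (shV-act₀ e d t))
    (ActStep.act-step bot (shiftVar e d) keepMat (λ _ _ _ → refl) (λ _ _ _ → refl) (λ _ _ _ eq → eq) act-substTop act-bot 0 0 st)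
    where
    act-substTop : ∀ c m k (τ : Vec Term k) b → act (shiftVar e d) keepMat c m (substTop τ b) ≡ substTop (V.map (act (shiftVar e d) keepMat c m) τ) (act (shiftVar e d) keepMat (k + c) m b)
    act-substTop c m k τ b = trans (act-shiftVar e d (sub 0 0 τ b) c m) (trans (shV-substTop (e + c) d τ b)
      (cong₂ (sub 0 0) (VP.map-cong (λ x → sym (act-shiftVar e d x c m)) τ)
        (trans (cong (λ z → shV z d b) (x∙yz≈y∙xz k e c)) (sym (act-shiftVar e d b (k + c) m)))))
    act-bot : ∀ c m → act (shiftVar e d) keepMat c m bot ≡ bot
    act-bot = ActScoped.act-closed (shiftVar e d) keepMat (λ c m i h → shV-var-< (m≤n⇒m≤o+n e h)) (λ _ _ _ → refl) bot cl

  shM-step : ∀ e d {s t} → Step R s t → Step R (shM e d s) (shM e d t)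
  shM-step e d {s} {t} st = Step-resp-≡ (sym (shM-act₀ e d s)) (sym (shM-act₀ e d t))
    (ActStep.act-step bot keepVar (shiftMat e d) (λ m i h → shiftIdx-< (m≤n⇒m≤o+n e h)) (shiftIdx-+ e d)
       (λ m x y eq → shiftIdx-injective (e + m) d x y eq) act-substTop act-bot 0 0 st)
    where
    act-substTop : ∀ c m k (τ : Vec Term k) b → act keepVar (shiftMat e d) c m (substTop τ b) ≡ substTop (V.map (act keepVar (shiftMat e d) c m) τ) (act keepVar (shiftMat e d) (k + c) m b)
    act-substTop c m k τ b = trans (act-shiftMat e d (sub 0 0 τ b) c m) (trans (shM-substTop (e + m) d τ b)
      (cong₂ (sub 0 0) (VP.map-cong (λ x → sym (act-shiftMat e d x c m)) τ) (sym (act-shiftMat e d b (k + c) m))))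
    act-bot : ∀ c m → act keepVar (shiftMat e d) c m bot ≡ bot
    act-bot = ActScoped.act-closed keepVar (shiftMat e d) (λ c m i h → refl) (λ m i h → shiftIdx-< (m≤n⇒m≤o+n e h)) bot cl

  sub-step : ∀ {n} e f (σ : Vec Term n) {s t} → Step R s t → Step R (sub e f σ s) (sub e f σ t)
  sub-step e f σ {s} {t} st = Step-resp-≡ (sym (sub-act₀ e f σ s)) (sym (sub-act₀ e f σ t))
    (ActStep.act-step bot (substVar e f σ) keepMat (λ _ _ _ → refl) (λ _ _ _ → refl) (λ _ _ _ eq → eq) act-substTop act-bot 0 0 st)
    where
    act-substTop : ∀ c m k (τ : Vec Term k) b → act (substVar e f σ) keepMat c m (substTop τ b) ≡ substTop (V.map (act (substVar e f σ) keepMat c m) τ) (act (substVar e f σ) keepMat (k + c) m b)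
    act-substTop c m k τ b = trans (act-substVar e f σ (sub 0 0 τ b) c m) (trans (sub-substTop (e + c) (f + m) σ τ b)
      (cong₂ (sub 0 0) (VP.map-cong (λ x → sym (act-substVar e f σ x c m)) τ)
        (trans (cong (λ z → sub z (f + m) σ b) (x∙yz≈y∙xz k e c)) (sym (act-substVar e f σ b (k + c) m)))))
    act-bot : ∀ c m → act (substVar e f σ) keepMat c m bot ≡ bot
    act-bot = ActScoped.act-closed (substVar e f σ) keepMat (λ c m i h → sub-var-< (m≤n⇒m≤o+n e h)) (λ _ _ _ → refl) bot cl

-- Strong normalisation

Env : Set
Env = ℕ → ℕ

extEnv : ℕ → ℕ → Env → Env
extEnv zero w ρ i = ρ i
extEnv (suc j) w ρ zero = w
extEnv (suc j) w ρ (suc i) = extEnv j w ρ i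

extEnv-< : ∀ j w ρ i → i < j → extEnv j w ρ i ≡ w
extEnv-< (suc j) w ρ zero h = refl
extEnv-< (suc j) w ρ (suc i) (s≤s h) = extEnv-< j w ρ i h

extEnv-+ : ∀ j w ρ i → extEnv j w ρ (j + i) ≡ ρ i
extEnv-+ zero w ρ i = refl
extEnv-+ (suc j) w ρ i = extEnv-+ j w ρ i

extEnv-mono : ∀ j {w w' ρ ρ'} → w ≤ w' → (∀ i → ρ i ≤ ρ' i) → ∀ i → extEnv j w ρ i ≤ extEnv j w' ρ' i
extEnv-mono zero h1 h2 i = h2 i
extEnv-mono (suc j) h1 h2 zero = h1
extEnv-mono (suc j) h1 h2 (suc i) = extEnv-mono j h1 h2 i

extEnv-cong : ∀ j w {ρ ρ'} → (∀ i → ρ i ≡ ρ' i) → ∀ i → extEnv j w ρ i ≡ extEnv j w ρ' i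
extEnv-cong zero w h i = h i
extEnv-cong (suc j) w h zero = refl
extEnv-cong (suc j) w h (suc i) = extEnv-cong j w h i

data Split (j : ℕ) : ℕ → Set where
  below : ∀ {i} → i < j → Split j i
  above : ∀ i → Split j (j + i)

split : ∀ j i → Split j i
split zero i = above i
split (suc j) zero = below (s≤s z≤n)
split (suc j) (suc i) with split j i
... | below h = below (s≤s h)
... | above i' = above i'

module Weight (B : ℕ) where
  mutual
    weight : Term → Env → ℕ
    weight (var i) ρ = ρ i
    weight (mat i) ρ = 0
    weight (app s t) ρ = suc (suc (weight s ρ + weight t ρ))
    weight (sapp s t) ρ = suc (weight s ρ + weight t ρ)
    weight (abs k p b) ρ = suc (weight p ρ + weight b (extEnv k 0 ρ))
    weight (em k b μ Δ) ρ = suc (weight b (extEnv k (weightμ μ ρ + weightΔ Δ ρ) ρ) + (weightμ μ ρ + weightΔ Δ ρ) + B)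

    weightμ : ∀ {k} → DMatch k → Env → ℕ
    weightμ nothing ρ = 0
    weightμ (just σ) ρ = weightv σ ρ

    weightv : ∀ {k} → Vec (Maybe Term) k → Env → ℕ
    weightv [] ρ = 0
    weightv (nothing ∷ σ) ρ = weightv σ ρ
    weightv (just t ∷ σ) ρ = weight t ρ + weightv σ ρ

    weightΔ : List (Term × Term) → Env → ℕ
    weightΔ [] ρ = 0
    weightΔ ((a , p) ∷ Δ) ρ = suc (weight a ρ + weight p ρ + weightΔ Δ ρ)

  mutual
    weight-mono : ∀ t {ρ ρ'} → (∀ i → ρ i ≤ ρ' i) → weight t ρ ≤ weight t ρ'
    weight-mono (var i) h = h i
    weight-mono (mat i) h = z≤n
    weight-mono (app s t) h = s≤s (s≤s (+-mono-≤ (weight-mono s h) (weight-mono t h)))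
    weight-mono (sapp s t) h = s≤s (+-mono-≤ (weight-mono s h) (weight-mono t h))
    weight-mono (abs k p b) h = s≤s (+-mono-≤ (weight-mono p h) (weight-mono b (extEnv-mono k ≤-refl h)))
    weight-mono (em k b μ Δ) h =
      let hw = +-mono-≤ (weightμ-mono μ h) (weightΔ-mono Δ h) in
      s≤s (+-mono-≤ (+-mono-≤ (weight-mono b (extEnv-mono k hw h)) hw) ≤-refl)

    weightμ-mono : ∀ {k} (μ : DMatch k) {ρ ρ'} → (∀ i → ρ i ≤ ρ' i) → weightμ μ ρ ≤ weightμ μ ρ'
    weightμ-mono nothing h = z≤n
    weightμ-mono (just σ) h = weightv-mono σ h

    weightv-mono : ∀ {k} (σ : Vec (Maybe Term) k) {ρ ρ'} → (∀ i → ρ i ≤ ρ' i) → weightv σ ρ ≤ weightv σ ρ'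
    weightv-mono [] h = z≤n
    weightv-mono (nothing ∷ σ) h = weightv-mono σ h
    weightv-mono (just t ∷ σ) h = +-mono-≤ (weight-mono t h) (weightv-mono σ h)

    weightΔ-mono : ∀ Δ {ρ ρ'} → (∀ i → ρ i ≤ ρ' i) → weightΔ Δ ρ ≤ weightΔ Δ ρ'
    weightΔ-mono [] h = z≤n
    weightΔ-mono ((a , p) ∷ Δ) h = s≤s (+-mono-≤ (+-mono-≤ (weight-mono a h) (weight-mono p h)) (weightΔ-mono Δ h))

  weight-cong : ∀ t {ρ ρ'} → (∀ i → ρ i ≡ ρ' i) → weight t ρ ≡ weight t ρ'
  weight-cong t h = ≤-antisym (weight-mono t (λ i → ≤-reflexive (h i))) (weight-mono t (λ i → ≤-reflexive (sym (h i))))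

  module WeightAct (V : VarAction) (M : MatAction)
    (agrees-extEnv : ∀ c ρ ρ' j w → (∀ m i → weight (V c m i) ρ ≡ ρ' i) → ∀ m i → weight (V (j + c) m i) (extEnv j w ρ) ≡ extEnv j w ρ' i) where
    Agrees : ℕ → Env → Env → Set
    Agrees c ρ ρ' = ∀ m i → weight (V c m i) ρ ≡ ρ' i
    mutual
      weight-act : ∀ t c m ρ ρ' → Agrees c ρ ρ' → weight (act V M c m t) ρ ≡ weight t ρ'
      weight-act (var i) c m ρ ρ' h = h m i
      weight-act (mat i) c m ρ ρ' h = refl
      weight-act (app s t) c m ρ ρ' h = cong₂ (λ x y → suc (suc (x + y))) (weight-act s c m ρ ρ' h) (weight-act t c m ρ ρ' h)
      weight-act (sapp s t) c m ρ ρ' h = cong₂ (λ x y → suc (x + y)) (weight-act s c m ρ ρ' h) (weight-act t c m ρ ρ' h)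
      weight-act (abs k p b) c m ρ ρ' h = cong₂ (λ x y → suc (x + y)) (weight-act p c (k + m) ρ ρ' h)
        (weight-act b (k + c) m (extEnv k 0 ρ) (extEnv k 0 ρ') (agrees-extEnv c ρ ρ' k 0 h))
      weight-act (em k b μ Δ) c m ρ ρ' h rewrite weightμ-act μ c m ρ ρ' h | weightΔ-act k Δ c m ρ ρ' h =
        cong (λ x → suc (x + (weightμ μ ρ' + weightΔ Δ ρ') + B))
          (weight-act b (k + c) m _ _ (agrees-extEnv c ρ ρ' k (weightμ μ ρ' + weightΔ Δ ρ') h))

      weightμ-act : ∀ {k} (μ : DMatch k) c m ρ ρ' → Agrees c ρ ρ' → weightμ (actμ V M c m μ) ρ ≡ weightμ μ ρ'
      weightμ-act nothing c m ρ ρ' h = refl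
      weightμ-act (just σ) c m ρ ρ' h = weightv-act σ c m ρ ρ' h

      weightv-act : ∀ {k} (σ : Vec (Maybe Term) k) c m ρ ρ' → Agrees c ρ ρ' → weightv (actv V M c m σ) ρ ≡ weightv σ ρ'
      weightv-act [] c m ρ ρ' h = refl
      weightv-act (nothing ∷ σ) c m ρ ρ' h = weightv-act σ c m ρ ρ' h
      weightv-act (just t ∷ σ) c m ρ ρ' h = cong₂ _+_ (weight-act t c m ρ ρ' h) (weightv-act σ c m ρ ρ' h)

      weightΔ-act : ∀ k Δ c m ρ ρ' → Agrees c ρ ρ' → weightΔ (actΔ V M k c m Δ) ρ ≡ weightΔ Δ ρ'
      weightΔ-act k [] c m ρ ρ' h = refl
      weightΔ-act k ((a , p) ∷ Δ) c m ρ ρ' h =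
        cong₂ (λ x y → suc (x + y)) (cong₂ _+_ (weight-act a c m ρ ρ' h) (weight-act p c (k + m) ρ ρ' h)) (weightΔ-act k Δ c m ρ ρ' h)

  weight-shM : ∀ e d x ρ → weight (shM e d x) ρ ≡ weight x ρ
  weight-shM e d x ρ = trans (cong (λ z → weight z ρ) (shM-act₀ e d x))
    (WeightAct.weight-act keepVar (shiftMat e d) (λ c ρ ρ' j w h m i → extEnv-cong j w (h m) i) x 0 0 ρ ρ (λ _ _ → refl))

  weight-shV₀ : ∀ n x ρ → weight (shV 0 n x) ρ ≡ weight x (λ i → ρ (i + n))
  weight-shV₀ n x ρ = trans (cong (λ z → weight z ρ) (shV-act₀ 0 n x))
    (WeightAct.weight-act (shiftVar 0 n) keepMat pext x 0 0 ρ (λ i → ρ (i + n)) (λ m i → cong (λ z → weight z ρ) (shV-var-≥ {0} {n} {i} z≤n)))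
    where
    pext : ∀ c ρ ρ' j w → (∀ m i → weight (shV c n (var i)) ρ ≡ ρ' i) → ∀ m i → weight (shV (j + c) n (var i)) (extEnv j w ρ) ≡ extEnv j w ρ' i
    pext c ρ ρ' j w h m i with split j i
    ... | below h' rewrite shV-var-< {j + c} {n} {i} (<-≤-trans h' (m≤m+n j c)) = trans (extEnv-< j w ρ i h') (sym (extEnv-< j w ρ' i h'))
    ... | above i' with i' <? c
    ...   | yes h2 rewrite shV-var-< {j + c} {n} {j + i'} (+-monoʳ-< j h2) | extEnv-+ j w ρ i' | extEnv-+ j w ρ' i' =
                trans (cong (λ z → weight z ρ) (sym (shV-var-< {c} {n} {i'} h2))) (h m i')
    ...   | no h2 rewrite shV-var-≥ {j + c} {n} {j + i'} (+-monoʳ-≤ j (≮⇒≥ h2)) | +-assoc j i' n | extEnv-+ j w ρ (i' + n) | extEnv-+ j w ρ' i' =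
                trans (cong (λ z → weight z ρ) (sym (shV-var-≥ {c} {n} {i'} (≮⇒≥ h2)))) (h m i')

  weight-sub-var-mat : ∀ {k} (τ : Vec Term k) m i ρ → weight (sub 0 m τ (var i)) ρ ≡ weight (sub 0 0 τ (var i)) ρ
  weight-sub-var-mat τ m i ρ with lookupℕ τ i in eq
  ... | just u = trans (weight-shV₀ 0 (shM 0 m u) ρ) (trans (weight-shM 0 m u _) (sym (trans (weight-shV₀ 0 (shM 0 0 u) ρ) (weight-shM 0 0 u _))))
  ... | nothing = refl

  weight-substTop : ∀ {k} (τ : Vec Term k) b ρ → weight (substTop τ b) ρ ≡ weight b (λ i → weight (sub 0 0 τ (var i)) ρ)
  weight-substTop {k} τ b ρ = trans (cong (λ z → weight z ρ) (sub-act₀ 0 0 τ b))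
    (WeightAct.weight-act (substVar 0 0 τ) keepMat pext b 0 0 ρ _ (λ m i → weight-sub-var-mat τ m i ρ))
    where
    pext : ∀ c ρ ρ' j w → (∀ m i → weight (sub c m τ (var i)) ρ ≡ ρ' i) → ∀ m i → weight (sub (j + c) m τ (var i)) (extEnv j w ρ) ≡ extEnv j w ρ' i
    pext c ρ ρ' j w h m i with split j i
    ... | below h' rewrite sub-var-< {k} {j + c} {m} {τ} {i} (<-≤-trans h' (m≤m+n j c)) = trans (extEnv-< j w ρ i h') (sym (extEnv-< j w ρ' i h'))
    ... | above i' with i' <? c
    ...   | yes h2 rewrite sub-var-< {k} {j + c} {m} {τ} {j + i'} (+-monoʳ-< j h2) | extEnv-+ j w ρ i' | extEnv-+ j w ρ' i' =
                trans (cong (λ z → weight z ρ) (sym (sub-var-< {k} {c} {m} {τ} {i'} h2))) (h m i')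
    ...   | no h2 with lookupℕ τ (i' ∸ c) in eq
    ...     | just u rewrite sub-var-just {k} {j + c} {m} {τ} {j + i'} (+-monoʳ-≤ j (≮⇒≥ h2)) (trans (cong (lookupℕ τ) ([m+n]∸[m+o]≡n∸o j i' c)) eq)
                  | extEnv-+ j w ρ' i' =
                trans (weight-shV₀ (j + c) (shM 0 m u) (extEnv j w ρ))
                  (trans (weight-cong (shM 0 m u) (λ x → trans (cong (extEnv j w ρ) (x∙yz≈y∙xz x j c)) (extEnv-+ j w ρ (x + c))))
                  (trans (sym (weight-shV₀ c (shM 0 m u) ρ))
                  (trans (cong (λ z → weight z ρ) (sym (sub-var-just {k} {c} {m} {τ} {i'} (≮⇒≥ h2) eq))) (h m i'))))
    ...     | nothing rewrite sub-var-nothing {k} {j + c} {m} {τ} {j + i'} (+-monoʳ-≤ j (≮⇒≥ h2)) (trans (cong (lookupℕ τ) ([m+n]∸[m+o]≡n∸o j i' c)) eq)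
                  | extEnv-+ j w ρ' i'
                  | +-∸-assoc j {i'} {k} (≤-trans (lookupℕ-nothing⇒≥ τ _ eq) (m∸n≤m i' c)) | extEnv-+ j w ρ (i' ∸ k) =
                trans (cong (λ z → weight z ρ) (sym (sub-var-nothing {k} {c} {m} {τ} {i'} (≮⇒≥ h2) eq))) (h m i')

  weight-substTop-var : ∀ {k} (τ : Vec Term k) W ρ → (∀ j u → lookupℕ τ j ≡ just u → weight u ρ ≤ W) →
    ∀ i → weight (sub 0 0 τ (var i)) ρ ≤ extEnv k W ρ i
  weight-substTop-var {k} τ W ρ hb i with split k i
  ... | below h with lookupℕ-< τ h
  ...   | u , eq rewrite sub-var-just {k} {0} {0} {τ} {i} z≤n eq | extEnv-< k W ρ i h =
          ≤-trans (≤-reflexive (trans (weight-shV₀ 0 (shM 0 0 u) ρ) (trans (weight-shM 0 0 u _) (weight-cong u (λ x → cong ρ (+-identityʳ x))))))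
                  (hb i u eq)
  weight-substTop-var {k} τ W ρ hb i | above i' rewrite sub-var-nothing {k} {0} {0} {τ} {k + i'} z≤n (lookupℕ-≥ τ (m≤m+n k i'))
                                          | m+n∸m≡n k i' | extEnv-+ k W ρ i' = ≤-refl

  weight-allJust : ∀ {k} (σ : Vec (Maybe Term) k) {τ} ρ → allJust σ ≡ just τ → ∀ j u → lookupℕ τ j ≡ just u → weight u ρ ≤ weightv σ ρ
  weight-allJust [] ρ refl j u ()
  weight-allJust (nothing ∷ σ) ρ ()
  weight-allJust (just t ∷ σ) ρ eq j u eq2 with allJust σ in e1
  weight-allJust (just t ∷ σ) ρ refl zero u refl | just τ = m≤m+n _ _
  weight-allJust (just t ∷ σ) ρ refl (suc j) u eq2 | just τ = ≤-trans (weight-allJust σ ρ e1 j u eq2) (m≤n+m _ _)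

  weightv-update : ∀ {k} (σ : Vec (Maybe Term) k) x a ρ → weightv (σ [ x ]≔ just a) ρ ≤ weightv σ ρ + weight a ρ
  weightv-update (nothing ∷ σ) zero a ρ = ≤-reflexive (+-comm (weight a ρ) (weightv σ ρ))
  weightv-update (just t ∷ σ) zero a ρ = ≤-trans (≤-reflexive (+-comm (weight a ρ) (weightv σ ρ))) (+-monoˡ-≤ (weight a ρ) (m≤n+m (weightv σ ρ) (weight t ρ)))
  weightv-update (nothing ∷ σ) (suc x) a ρ = weightv-update σ x a ρ
  weightv-update (just t ∷ σ) (suc x) a ρ = ≤-trans (+-monoʳ-≤ (weight t ρ) (weightv-update σ x a ρ)) (≤-reflexive (sym (+-assoc (weight t ρ) _ _)))

  weightμ-extend : ∀ {k} (μ : DMatch k) x a ρ → weightμ (extend μ x a) ρ ≤ weightμ μ ρ + weight a ρ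
  weightμ-extend nothing x a ρ = z≤n
  weightμ-extend (just σ) x a ρ with lookup σ x
  ... | just _ = z≤n
  ... | nothing = weightv-update σ x a ρ

  weightΔ-++ : ∀ Δ1 Δ2 ρ → weightΔ (Δ1 ++ Δ2) ρ ≡ weightΔ Δ1 ρ + weightΔ Δ2 ρ
  weightΔ-++ [] Δ2 ρ = refl
  weightΔ-++ ((a , p) ∷ Δ1) Δ2 ρ = cong suc (trans (cong (weight a ρ + weight p ρ +_) (weightΔ-++ Δ1 Δ2 ρ)) (sym (+-assoc (weight a ρ + weight p ρ) _ _)))

  weightΔ-remove-pair : ∀ Δ1 Δ2 a p ρ → weight a ρ + weightΔ (Δ1 ++ Δ2) ρ < weightΔ (Δ1 ++ (a , p) ∷ Δ2) ρ
  weightΔ-remove-pair Δ1 Δ2 a p ρ rewrite weightΔ-++ Δ1 Δ2 ρ | weightΔ-++ Δ1 ((a , p) ∷ Δ2) ρ =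
    ≤-trans (s≤s (≤-trans (≤-reflexive (x∙yz≈y∙xz (weight a ρ) (weightΔ Δ1 ρ) (weightΔ Δ2 ρ)))
                       (+-monoʳ-≤ (weightΔ Δ1 ρ) (+-monoˡ-≤ (weightΔ Δ2 ρ) (m≤m+n (weight a ρ) (weight p ρ))))))
            (≤-reflexive (sym (+-suc (weightΔ Δ1 ρ) _)))

  weightΔ-drop-pair : ∀ Δ1 Δ2 a p ρ → weightΔ (Δ1 ++ Δ2) ρ < weightΔ (Δ1 ++ (a , p) ∷ Δ2) ρ
  weightΔ-drop-pair Δ1 Δ2 a p ρ = ≤-trans (s≤s (m≤n+m _ (weight a ρ))) (weightΔ-remove-pair Δ1 Δ2 a p ρ)

  weightΔ-decompose : ∀ Δ1 Δ2 a₁ a₂ p₁ p₂ ρ → weightΔ (Δ1 ++ (a₁ , p₁) ∷ (a₂ , p₂) ∷ Δ2) ρ < weightΔ (Δ1 ++ (sapp a₁ a₂ , sapp p₁ p₂) ∷ Δ2) ρ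
  weightΔ-decompose Δ1 Δ2 a₁ a₂ p₁ p₂ ρ rewrite weightΔ-++ Δ1 ((a₁ , p₁) ∷ (a₂ , p₂) ∷ Δ2) ρ | weightΔ-++ Δ1 ((sapp a₁ a₂ , sapp p₁ p₂) ∷ Δ2) ρ =
    +-monoʳ-< (weightΔ Δ1 ρ) (≤-reflexive (regroup (weight a₁ ρ) (weight a₂ ρ) (weight p₁ ρ) (weight p₂ ρ) (weightΔ Δ2 ρ)))
    where
    regroup : ∀ a₁ a₂ p₁ p₂ d → 2 + (a₁ + p₁ + (1 + (a₂ + p₂ + d))) ≡ 1 + ((1 + (a₁ + a₂)) + (1 + (p₁ + p₂)) + d)
    regroup = solve-∀

  weight-em-< : ∀ k b W W' ρ → W' < W → suc (weight b (extEnv k W' ρ) + W' + B) < suc (weight b (extEnv k W ρ) + W + B)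
  weight-em-< k b W W' ρ h = s≤s (+-monoˡ-< B (+-mono-≤-< (weight-mono b (extEnv-mono k (<⇒≤ h) (λ _ → ≤-refl))) h))

  module Decrease (bot : Term) (weight-bot : ∀ ρ → weight bot ρ ≡ B) where
    R : Term → Term → Set
    R = PRoot bot

    weight-root-< : ∀ ρ {s t} → R s t → weight t ρ < weight s ρ
    weight-root-< ρ bullet-mat = ≤-refl
    weight-root-< ρ bullet-sapp = ≤-refl
    weight-root-< ρ (m-bind {k} {b} {μ} {Δ₁} {Δ₂} {a} x) = weight-em-< k b _ _ ρ
      (≤-trans (s≤s (+-monoˡ-≤ _ (weightμ-extend μ x a ρ)))
        (≤-trans (≤-reflexive (cong suc (+-assoc (weightμ μ ρ) (weight a ρ) _)))
          (≤-trans (≤-reflexive (sym (+-suc (weightμ μ ρ) _))) (+-monoʳ-≤ (weightμ μ ρ) (weightΔ-remove-pair Δ₁ Δ₂ a _ ρ)))))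
    weight-root-< ρ (m-same {k} {b} {μ} {Δ₁} {Δ₂}) = weight-em-< k b _ _ ρ (+-monoʳ-< (weightμ μ ρ) (weightΔ-drop-pair Δ₁ Δ₂ _ _ ρ))
    weight-root-< ρ (m-decomp {k} {b} {μ} {Δ₁} {Δ₂}) = weight-em-< k b _ _ ρ (+-monoʳ-< (weightμ μ ρ) (weightΔ-decompose Δ₁ Δ₂ _ _ _ _ ρ))
    weight-root-< ρ (m-fail {k} {b} {μ} {Δ₁} {Δ₂} f) = weight-em-< k b _ _ ρ (≤-trans (weightΔ-drop-pair Δ₁ Δ₂ _ _ ρ) (m≤n+m _ (weightμ μ ρ)))
    weight-root-< ρ (r-subst {k} {b} {σ} {τ} eq) rewrite weight-substTop τ b ρ =
      s≤s (≤-trans (weight-mono b (weight-substTop-var τ (weightv σ ρ + 0) ρ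
              (λ j u e → ≤-trans (weight-allJust σ ρ eq j u e) (m≤m+n _ 0))))
           (≤-trans (m≤m+n _ _) (m≤m+n _ B)))
    weight-root-< ρ (r-dom eq) rewrite weight-bot ρ = s≤s (m≤n+m B _)
    weight-root-< ρ r-fail rewrite weight-bot ρ = s≤s (m≤n+m B _)

    mutual
      weight-step-< : ∀ ρ {s t} → Step R s t → weight t ρ < weight s ρ
      weight-step-< ρ (root r) = weight-root-< ρ r
      weight-step-< ρ (appL {t = t} st) = s≤s (s≤s (+-monoˡ-< (weight t ρ) (weight-step-< ρ st)))
      weight-step-< ρ (appR {s = s} st) = s≤s (s≤s (+-monoʳ-< (weight s ρ) (weight-step-< ρ st)))
      weight-step-< ρ (sappL {t = t} st) = s≤s (+-monoˡ-< (weight t ρ) (weight-step-< ρ st))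
      weight-step-< ρ (sappR {s = s} st) = s≤s (+-monoʳ-< (weight s ρ) (weight-step-< ρ st))
      weight-step-< ρ (absP {k} {b = b} st) = s≤s (+-monoˡ-< (weight b (extEnv k 0 ρ)) (weight-step-< ρ st))
      weight-step-< ρ (absB {k} {p} st) = s≤s (+-monoʳ-< (weight p ρ) (weight-step-< (extEnv k 0 ρ) st))
      weight-step-< ρ (emB {k} {μ = μ} {Δ} st) = s≤s (+-monoˡ-< B (+-monoˡ-< (weightμ μ ρ + weightΔ Δ ρ) (weight-step-< _ st)))
      weight-step-< ρ (emμ {k} {b} {Δ = Δ} st) = weight-em-< k b _ _ ρ (+-monoˡ-< (weightΔ Δ ρ) (weight-stepV-< ρ st))
      weight-step-< ρ (emΔ {k} {b} {μ} st) = weight-em-< k b _ _ ρ (+-monoʳ-< (weightμ μ ρ) (weight-stepΔ-< ρ st))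

      weight-stepV-< : ∀ ρ {k} {σ σ' : Vec (Maybe Term) k} → StepV R σ σ' → weightv σ' ρ < weightv σ ρ
      weight-stepV-< ρ (here {σ = σ} st) = +-monoˡ-< (weightv σ ρ) (weight-step-< ρ st)
      weight-stepV-< ρ (there {x = nothing} st) = weight-stepV-< ρ st
      weight-stepV-< ρ (there {x = just t} st) = +-monoʳ-< (weight t ρ) (weight-stepV-< ρ st)

      weight-stepΔ-< : ∀ ρ {Δ Δ'} → StepΔ R Δ Δ' → weightΔ Δ' ρ < weightΔ Δ ρ
      weight-stepΔ-< ρ (fstS {p = p} {Δ} st) = s≤s (+-monoˡ-< (weightΔ Δ ρ) (+-monoˡ-< (weight p ρ) (weight-step-< ρ st)))
      weight-stepΔ-< ρ (sndS {a} {Δ = Δ} st) = s≤s (+-monoˡ-< (weightΔ Δ ρ) (+-monoʳ-< (weight a ρ) (weight-step-< ρ st)))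
      weight-stepΔ-< ρ (there {x = (a , p)} st) = s≤s (+-monoʳ-< (weight a ρ + weight p ρ) (weight-stepΔ-< ρ st))

    weight-wellFounded : WellFounded (flip (Step R))
    weight-wellFounded =
      Subrelation.wellFounded (weight-step-< (λ _ → 0)) (On.wellFounded (λ t → weight t (λ _ → 0)) <-wellFounded)

extEnv-agree : ∀ k w {nv} {ρ ρ' : Env} → (∀ i → i < nv → ρ i ≡ ρ' i) → ∀ i → i < k + nv → extEnv k w ρ i ≡ extEnv k w ρ' i
extEnv-agree zero w h i q = h i q
extEnv-agree (suc k) w h zero q = refl
extEnv-agree (suc k) w h (suc i) (s≤s q) = extEnv-agree k w h i q

weight-pure : ∀ B B' t {nv nm} → Scoped nv nm t → NoSappEm t → {ρ ρ' : Env} → (∀ i → i < nv → ρ i ≡ ρ' i) →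
  Weight.weight B t ρ ≡ Weight.weight B' t ρ'
weight-pure B B' (var i) sc ns h = h i sc
weight-pure B B' (mat i) sc ns h = refl
weight-pure B B' (app s t) (s1 , s2) (n1 , n2) h = cong₂ (λ x y → suc (suc (x + y))) (weight-pure B B' s s1 n1 h) (weight-pure B B' t s2 n2 h)
weight-pure B B' (abs k p b) (s1 , s2) (n1 , n2) h =
  cong₂ (λ x y → suc (x + y)) (weight-pure B B' p s1 n1 h) (weight-pure B B' b s2 n2 (extEnv-agree k 0 h))

⟶p-SN : ∀ bot → Closed bot → NoSappEm bot → WellFounded (flip (Step (PRoot bot)))
⟶p-SN bot cl ns = Weight.Decrease.weight-wellFounded B0 bot (λ ρ → weight-pure B0 0 bot cl ns (λ i ()))
  where
  B0 : ℕ
  B0 = Weight.weight 0 bot (λ _ → 0)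

-- Local confluence

Joinable : ∀ {A : Set} → (A → A → Set) → A → A → Set
Joinable _⟶_ a b = ∃[ c ] (Star _⟶_ a c × Star _⟶_ b c)

Joinable-sym : ∀ {A : Set} {_⟶_ : A → A → Set} {a b} → Joinable _⟶_ a b → Joinable _⟶_ b a
Joinable-sym (c , p , q) = c , q , p

Joinable-map : ∀ {A B : Set} {_⟶₁_ : A → A → Set} {_⟶₂_ : B → B → Set} (f : A → B) →
  (∀ {a b} → a ⟶₁ b → f a ⟶₂ f b) → ∀ {a b} → Joinable _⟶₁_ a b → Joinable _⟶₂_ (f a) (f b)
Joinable-map f g (c , p , q) = f c , gmap f g p , gmap f g q

data PosView {A : Set} : List A → A → List A → List A → A → List A → Set where
  samePos : ∀ {Δ₁ x Δ₂} → PosView Δ₁ x Δ₂ Δ₁ x Δ₂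
  leftPos : ∀ {Δ₁ x Γ y Δ₂'} → PosView Δ₁ x (Γ ++ y ∷ Δ₂') (Δ₁ ++ x ∷ Γ) y Δ₂'
  rightPos : ∀ {Δ₁' y Γ x Δ₂} → PosView (Δ₁' ++ y ∷ Γ) x Δ₂ Δ₁' y (Γ ++ x ∷ Δ₂)

posView : ∀ {A : Set} Δ₁ (x : A) Δ₂ Δ₁' y Δ₂' → Δ₁ ++ x ∷ Δ₂ ≡ Δ₁' ++ y ∷ Δ₂' → PosView Δ₁ x Δ₂ Δ₁' y Δ₂'
posView [] x Δ₂ [] y Δ₂' refl = samePos
posView [] x Δ₂ (z ∷ Δ₁') y Δ₂' refl = leftPos
posView (z ∷ Δ₁) x Δ₂ [] y Δ₂' refl = rightPos
posView (z ∷ Δ₁) x Δ₂ (w ∷ Δ₁') y Δ₂' eq with ∷-injective eq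
... | refl , eq' with posView Δ₁ x Δ₂ Δ₁' y Δ₂' eq'
...   | samePos = samePos
...   | leftPos = leftPos
...   | rightPos = rightPos

[]≢++∷ : ∀ {A : Set} (Δ₁ : List A) x Δ₂ → [] ≡ Δ₁ ++ x ∷ Δ₂ → ⊥
[]≢++∷ [] x Δ₂ ()
[]≢++∷ (y ∷ Δ₁) x Δ₂ ()

data MatchStep (k : ℕ) : DMatch k → Term × Term → DMatch k → List (Term × Term) → Set where
  bind : ∀ {μ a} (x : Fin k) → MatchStep k μ (a , mat (toℕ x)) (extend μ x a) []
  same : ∀ {μ y} → MatchStep k μ (mat y , mat (k + y)) μ []
  decomp : ∀ {μ a₁ a₂ p₁ p₂} → MatchStep k μ (sapp a₁ a₂ , sapp p₁ p₂) μ ((a₁ , p₁) ∷ (a₂ , p₂) ∷ [])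
  fail : ∀ {μ a p} → Fails k a p → MatchStep k μ (a , p) nothing []

-- PRoot with the four (m) rules factored through MatchStep on the selected
-- pair, so that two (m) steps at the root can be compared by position.
data RootView (bot : Term) : Term → Term → Set where
  view-bullet-mat : ∀ {x t} → RootView bot (app (mat x) t) (sapp (mat x) t)
  view-bullet-sapp : ∀ {t₁ t₂ t₃} → RootView bot (app (sapp t₁ t₂) t₃) (sapp (sapp t₁ t₂) t₃)
  view-match : ∀ {k b μ Δ Δ₁ x Δ₂ μ' ys} → Δ ≡ Δ₁ ++ x ∷ Δ₂ → MatchStep k μ x μ' ys →
       RootView bot (em k b μ Δ) (em k b μ' (Δ₁ ++ ys ++ Δ₂))
  view-subst : ∀ {k b σ τ} → allJust σ ≡ just τ → RootView bot (em k b (just σ) []) (substTop τ b)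
  view-dom : ∀ {k b σ} → allJust σ ≡ nothing → RootView bot (em k b (just σ) []) bot
  view-fail : ∀ {k b Δ} → RootView bot (em k b nothing Δ) bot

extend-defined : ∀ {k} (σ : Vec (Maybe Term) k) x a {u} → lookup σ x ≡ just u → extend (just σ) x a ≡ nothing
extend-defined σ x a e with lookup σ x
extend-defined σ x a refl | just _ = refl

extend-undefined : ∀ {k} (σ : Vec (Maybe Term) k) x a → lookup σ x ≡ nothing → extend (just σ) x a ≡ just (σ [ x ]≔ just a)
extend-undefined σ x a e with lookup σ x
extend-undefined σ x a refl | nothing = refl

extend-twice : ∀ {k} (μ : DMatch k) x a b → extend (extend μ x a) x b ≡ nothing
extend-twice nothing x a b = refl
extend-twice (just σ) x a b with lookup σ x in e
... | just u = refl
... | nothing = extend-defined (σ [ x ]≔ just a) x b (VP.lookup∘update x σ (just a))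

extend-comm : ∀ {k} (μ : DMatch k) x a y b → extend (extend μ x a) y b ≡ extend (extend μ y b) x a
extend-comm nothing x a y b = refl
extend-comm (just σ) x a y b with x ≟F y
... | yes refl = trans (extend-twice (just σ) x a b) (sym (extend-twice (just σ) x b a))
... | no ne = go (lookup σ x) refl (lookup σ y) refl
  where
  go : ∀ w1 → lookup σ x ≡ w1 → ∀ w2 → lookup σ y ≡ w2 → extend (extend (just σ) x a) y b ≡ extend (extend (just σ) y b) x a
  go (just u) e1 (just v) e2 = trans (cong (λ z → extend z y b) (extend-defined σ x a e1)) (sym (cong (λ z → extend z x a) (extend-defined σ y b e2)))
  go (just u) e1 nothing e2 = trans (cong (λ z → extend z y b) (extend-defined σ x a e1))
    (sym (trans (cong (λ z → extend z x a) (extend-undefined σ y b e2)) (extend-defined _ x a (trans (VP.lookup∘update′ ne σ (just b)) e1))))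
  go nothing e1 (just v) e2 = trans (trans (cong (λ z → extend z y b) (extend-undefined σ x a e1))
      (extend-defined _ y b (trans (VP.lookup∘update′ (λ q → ne (sym q)) σ (just a)) e2)))
    (sym (cong (λ z → extend z x a) (extend-defined σ y b e2)))
  go nothing e1 nothing e2 = trans (trans (cong (λ z → extend z y b) (extend-undefined σ x a e1))
      (extend-undefined _ y b (trans (VP.lookup∘update′ (λ q → ne (sym q)) σ (just a)) e2)))
    (trans (cong just (VP.[]≔-commutes σ x y ne))
    (sym (trans (cong (λ z → extend z x a) (extend-undefined σ y b e2)) (extend-undefined _ x a (trans (VP.lookup∘update′ ne σ (just b)) e1)))))

matIndex : Term → ℕ
matIndex (mat i) = i
matIndex _ = 0

matchUpdate : ∀ {k μ x μ' ys} → MatchStep k μ x μ' ys → DMatch k → DMatch k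
matchUpdate (bind {a = a} x) ν = extend ν x a
matchUpdate same ν = ν
matchUpdate decomp ν = ν
matchUpdate (fail f) ν = nothing

matchStep-at : ∀ {k μ x μ' ys} (r : MatchStep k μ x μ' ys) ν → MatchStep k ν x (matchUpdate r ν) ys
matchStep-at (bind x) ν = bind x
matchStep-at same ν = same
matchStep-at decomp ν = decomp
matchStep-at (fail f) ν = fail f

matchUpdate-self : ∀ {k μ x μ' ys} (r : MatchStep k μ x μ' ys) → matchUpdate r μ ≡ μ'
matchUpdate-self (bind x) = refl
matchUpdate-self same = refl
matchUpdate-self decomp = refl
matchUpdate-self (fail f) = refl

matchStep-from-⊥ : ∀ {k x μ' ys} (r : MatchStep k nothing x μ' ys) → μ' ≡ nothing
matchStep-from-⊥ (bind x) = refl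
matchStep-from-⊥ same = refl
matchStep-from-⊥ decomp = refl
matchStep-from-⊥ (fail f) = refl

matchUpdate-comm : ∀ {k μ1 μ2 x y μ1' μ2' xs ys} (r1 : MatchStep k μ1 x μ1' xs) (r2 : MatchStep k μ2 y μ2' ys) ν →
  matchUpdate r1 (matchUpdate r2 ν) ≡ matchUpdate r2 (matchUpdate r1 ν)
matchUpdate-comm (bind x) (bind y) ν = extend-comm ν y _ x _
matchUpdate-comm (bind x) same ν = refl
matchUpdate-comm (bind x) decomp ν = refl
matchUpdate-comm (bind x) (fail f) ν = refl
matchUpdate-comm same (bind y) ν = refl
matchUpdate-comm same same ν = refl
matchUpdate-comm same decomp ν = refl
matchUpdate-comm same (fail f) ν = refl
matchUpdate-comm decomp (bind y) ν = refl
matchUpdate-comm decomp same ν = refl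
matchUpdate-comm decomp decomp ν = refl
matchUpdate-comm decomp (fail f) ν = refl
matchUpdate-comm (fail f) (bind y) ν = refl
matchUpdate-comm (fail f) same ν = refl
matchUpdate-comm (fail f) decomp ν = refl
matchUpdate-comm (fail f) (fail g) ν = refl

<⇒≢+ : ∀ {k x y} → x < k → x ≡ k + y → ⊥
<⇒≢+ {k} {x} {y} h refl = <⇒≱ h (m≤m+n k y)

¬Fails-bound : ∀ {k a} (x : Fin k) → ¬ Fails k a (mat (toℕ x))
¬Fails-bound x (mat-mat h ne) = <⇒≱ (toℕ<n x) h
¬Fails-bound x (sapp-mat h) = <⇒≱ (toℕ<n x) h
¬Fails-bound x (abs-mat h) = <⇒≱ (toℕ<n x) h

matchStep-deterministic : ∀ {k μ x x' μ1 μ2 ys zs} → MatchStep k μ x μ1 ys → MatchStep k μ x' μ2 zs → x ≡ x' → μ1 ≡ μ2 × ys ≡ zs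
matchStep-deterministic {μ = μ} (bind x) (bind x') eq =
  cong₂ (extend μ) (toℕ-injective (cong (λ q → matIndex (proj₂ q)) eq)) (cong proj₁ eq) , refl
matchStep-deterministic (bind x) same eq = ⊥-elim (<⇒≢+ (toℕ<n x) (cong (λ q → matIndex (proj₂ q)) eq))
matchStep-deterministic (bind x) decomp ()
matchStep-deterministic (bind x) (fail f) refl = ⊥-elim (¬Fails-bound x f)
matchStep-deterministic same (bind x) eq = ⊥-elim (<⇒≢+ (toℕ<n x) (sym (cong (λ q → matIndex (proj₂ q)) eq)))
matchStep-deterministic same same refl = refl , refl
matchStep-deterministic same decomp ()
matchStep-deterministic same (fail (mat-mat h ne)) refl = ⊥-elim (ne refl)
matchStep-deterministic decomp (bind x) ()
matchStep-deterministic decomp same ()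
matchStep-deterministic decomp decomp refl = refl , refl
matchStep-deterministic decomp (fail ()) refl
matchStep-deterministic (fail f) (bind x) refl = ⊥-elim (¬Fails-bound x f)
matchStep-deterministic (fail (mat-mat h ne)) same refl = ⊥-elim (ne refl)
matchStep-deterministic (fail ()) decomp refl
matchStep-deterministic (fail f) (fail g) refl = refl , refl

module LocalConfluence {bot : Term} (cl : Closed bot) where
  private
    infix 4 _⟶_ _⟶*_ _⟶ᵛ_ _⟶Δ_

    _⟶_ : Term → Term → Set
    _⟶_ = Step (PRoot bot)

    _⟶*_ : Term → Term → Set
    _⟶*_ = Star _⟶_

    _⟶ᵛ_ : ∀ {k} → Vec (Maybe Term) k → Vec (Maybe Term) k → Set
    _⟶ᵛ_ = StepV (PRoot bot)

    _⟶Δ_ : List (Term × Term) → List (Term × Term) → Set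
    _⟶Δ_ = StepΔ (PRoot bot)

  toRootView : ∀ {s t} → PRoot bot s t → RootView bot s t
  toRootView bullet-mat = view-bullet-mat
  toRootView bullet-sapp = view-bullet-sapp
  toRootView (m-bind x) = view-match refl (bind x)
  toRootView m-same = view-match refl same
  toRootView m-decomp = view-match refl decomp
  toRootView (m-fail f) = view-match refl (fail f)
  toRootView (r-subst eq) = view-subst eq
  toRootView (r-dom eq) = view-dom eq
  toRootView r-fail = view-fail

  matchStep-root : ∀ {k b μ Δ₁ x Δ₂ μ' ys} → MatchStep k μ x μ' ys → PRoot bot (em k b μ (Δ₁ ++ x ∷ Δ₂)) (em k b μ' (Δ₁ ++ ys ++ Δ₂))
  matchStep-root (bind x) = m-bind x
  matchStep-root same = m-same
  matchStep-root decomp = m-decomp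
  matchStep-root (fail f) = m-fail f

  fromRootView : ∀ {s t} → RootView bot s t → PRoot bot s t
  fromRootView view-bullet-mat = bullet-mat
  fromRootView view-bullet-sapp = bullet-sapp
  fromRootView (view-match refl r) = matchStep-root r
  fromRootView (view-subst eq) = r-subst eq
  fromRootView (view-dom eq) = r-dom eq
  fromRootView view-fail = r-fail

  mat-irreducible : ∀ {x t} → ¬ (mat x ⟶ t)
  mat-irreducible (root ())

  sapp-step-view : ∀ {s t u} → sapp s t ⟶ u →
    (Σ Term λ s' → u ≡ sapp s' t × s ⟶ s') ⊎ (Σ Term λ t' → u ≡ sapp s t' × t ⟶ t')
  sapp-step-view (root ())
  sapp-step-view (sappL st) = inj₁ (_ , refl , st)
  sapp-step-view (sappR st) = inj₂ (_ , refl , st)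

  abs-step-shape : ∀ {k p b u} → abs k p b ⟶ u → Σ Term λ p' → Σ Term λ b' → u ≡ abs k p' b'
  abs-step-shape (root ())
  abs-step-shape (absP st) = _ , _ , refl
  abs-step-shape (absB st) = _ , _ , refl

  Fails-stepᵃ : ∀ {k a a' p} → Fails k a p → a ⟶ a' → Fails k a' p
  Fails-stepᵃ (mat-mat h ne) st = ⊥-elim (mat-irreducible st)
  Fails-stepᵃ (sapp-mat h) st with sapp-step-view st
  ... | inj₁ (_ , refl , _) = sapp-mat h
  ... | inj₂ (_ , refl , _) = sapp-mat h
  Fails-stepᵃ (abs-mat h) st with abs-step-shape st
  ... | _ , _ , refl = abs-mat h
  Fails-stepᵃ mat-sapp st = ⊥-elim (mat-irreducible st)
  Fails-stepᵃ abs-sapp st with abs-step-shape st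
  ... | _ , _ , refl = abs-sapp
  Fails-stepᵃ any-abs st = any-abs

  Fails-stepᵖ : ∀ {k a p p'} → Fails k a p → p ⟶ p' → Fails k a p'
  Fails-stepᵖ (mat-mat h ne) st = ⊥-elim (mat-irreducible st)
  Fails-stepᵖ (sapp-mat h) st = ⊥-elim (mat-irreducible st)
  Fails-stepᵖ (abs-mat h) st = ⊥-elim (mat-irreducible st)
  Fails-stepᵖ mat-sapp st with sapp-step-view st
  ... | inj₁ (_ , refl , _) = mat-sapp
  ... | inj₂ (_ , refl , _) = mat-sapp
  Fails-stepᵖ abs-sapp st with sapp-step-view st
  ... | inj₁ (_ , refl , _) = abs-sapp
  ... | inj₂ (_ , refl , _) = abs-sapp
  Fails-stepᵖ any-abs st with abs-step-shape st
  ... | _ , _ , refl = any-abs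

  stepΔ-++ˡ : ∀ {Δ₁ Δ₁'} Γ → Δ₁ ⟶Δ Δ₁' → (Δ₁ ++ Γ) ⟶Δ (Δ₁' ++ Γ)
  stepΔ-++ˡ Γ (fstS st) = fstS st
  stepΔ-++ˡ Γ (sndS st) = sndS st
  stepΔ-++ˡ Γ (there st) = there (stepΔ-++ˡ Γ st)

  stepΔ-++ʳ : ∀ Δ₁ {Γ Γ'} → Γ ⟶Δ Γ' → (Δ₁ ++ Γ) ⟶Δ (Δ₁ ++ Γ')
  stepΔ-++ʳ [] st = st
  stepΔ-++ʳ (x ∷ Δ₁) st = there (stepΔ-++ʳ Δ₁ st)

  data PairStep : Term × Term → Term × Term → Set where
    argStep : ∀ {a a' p} → a ⟶ a' → PairStep (a , p) (a' , p)
    patStep : ∀ {a p p'} → p ⟶ p' → PairStep (a , p) (a , p')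

  data AppView (Δ₁ : List (Term × Term)) (x : Term × Term) (Δ₂ : List (Term × Term)) : List (Term × Term) → Set where
    inL : ∀ {Δ₁'} → Δ₁ ⟶Δ Δ₁' → AppView Δ₁ x Δ₂ (Δ₁' ++ x ∷ Δ₂)
    inM : ∀ {x'} → PairStep x x' → AppView Δ₁ x Δ₂ (Δ₁ ++ x' ∷ Δ₂)
    inR : ∀ {Δ₂'} → Δ₂ ⟶Δ Δ₂' → AppView Δ₁ x Δ₂ (Δ₁ ++ x ∷ Δ₂')

  appView : ∀ Δ₁ x Δ₂ {Δ'} → (Δ₁ ++ x ∷ Δ₂) ⟶Δ Δ' → AppView Δ₁ x Δ₂ Δ'
  appView [] x Δ₂ (fstS st) = inM (argStep st)
  appView [] x Δ₂ (sndS st) = inM (patStep st)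
  appView [] x Δ₂ (there st) = inR st
  appView (y ∷ Δ₁) x Δ₂ (fstS st) = inL (fstS st)
  appView (y ∷ Δ₁) x Δ₂ (sndS st) = inL (sndS st)
  appView (y ∷ Δ₁) x Δ₂ (there st) with appView Δ₁ x Δ₂ st
  ... | inL s = inL (there s)
  ... | inM s = inM s
  ... | inR s = inR s

  DMatchStep : ∀ {k} → DMatch k → DMatch k → Set
  DMatchStep μ1 μ2 = μ1 ≡ μ2 ⊎ Σ _ λ σ1 → Σ _ λ σ2 → μ1 ≡ just σ1 × μ2 ≡ just σ2 × σ1 ⟶ᵛ σ2

  DMatchStep-em : ∀ {k b Δ} {μ1 μ2 : DMatch k} → DMatchStep μ1 μ2 → em k b μ1 Δ ⟶* em k b μ2 Δ
  DMatchStep-em (inj₁ refl) = ε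
  DMatchStep-em (inj₂ (_ , _ , refl , refl , st)) = emμ st ◅ ε

  lookup-stepV-nothing : ∀ {k} {σ σ' : Vec (Maybe Term) k} → σ ⟶ᵛ σ' → ∀ x → lookup σ x ≡ nothing → lookup σ' x ≡ nothing
  lookup-stepV-nothing (here st) zero ()
  lookup-stepV-nothing (here st) (suc x) e = e
  lookup-stepV-nothing (there st) zero e = e
  lookup-stepV-nothing (there st) (suc x) e = lookup-stepV-nothing st x e

  lookup-stepV-just : ∀ {k} {σ σ' : Vec (Maybe Term) k} → σ ⟶ᵛ σ' → ∀ x {u} → lookup σ x ≡ just u → Σ Term λ u' → lookup σ' x ≡ just u'
  lookup-stepV-just (here st) zero refl = _ , refl
  lookup-stepV-just (here st) (suc x) e = _ , e
  lookup-stepV-just (there st) zero e = _ , e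
  lookup-stepV-just (there st) (suc x) e = lookup-stepV-just st x e

  stepV-update : ∀ {k} {σ σ' : Vec (Maybe Term) k} → σ ⟶ᵛ σ' → ∀ x a → lookup σ x ≡ nothing → (σ [ x ]≔ just a) ⟶ᵛ (σ' [ x ]≔ just a)
  stepV-update (here st) zero a ()
  stepV-update (here st) (suc x) a e = here st
  stepV-update (there st) zero a e = there st
  stepV-update (there st) (suc x) a e = there (stepV-update st x a e)

  update-stepV : ∀ {k} (σ : Vec (Maybe Term) k) x {a a'} → a ⟶ a' → (σ [ x ]≔ just a) ⟶ᵛ (σ [ x ]≔ just a')
  update-stepV (_ ∷ σ) zero st = here st
  update-stepV (_ ∷ σ) (suc x) st = there (update-stepV σ x st)

  extend-stepV : ∀ {k} {σ σ' : Vec (Maybe Term) k} x a → σ ⟶ᵛ σ' → DMatchStep (extend (just σ) x a) (extend (just σ') x a)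
  extend-stepV {σ = σ} {σ'} x a st = go (lookup σ x) refl
    where
    go : ∀ w → lookup σ x ≡ w → DMatchStep (extend (just σ) x a) (extend (just σ') x a)
    go (just u) e = inj₁ (trans (extend-defined σ x a e) (sym (extend-defined σ' x a (proj₂ (lookup-stepV-just st x e)))))
    go nothing e = inj₂ (_ , _ , extend-undefined σ x a e , extend-undefined σ' x a (lookup-stepV-nothing st x e) , stepV-update st x a e)

  extend-step : ∀ {k} (μ : DMatch k) x {a a'} → a ⟶ a' → DMatchStep (extend μ x a) (extend μ x a')
  extend-step nothing x st = inj₁ refl
  extend-step (just σ) x {a} {a'} st = go (lookup σ x) refl
    where
    go : ∀ w → lookup σ x ≡ w → DMatchStep (extend (just σ) x a) (extend (just σ) x a')
    go (just u) e = inj₁ (trans (extend-defined σ x a e) (sym (extend-defined σ x a' e)))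
    go nothing e = inj₂ (_ , _ , extend-undefined σ x a e , extend-undefined σ x a' e , update-stepV σ x st)

  matchUpdate-stepV : ∀ {k μ x μ' ys} (r : MatchStep k μ x μ' ys) {σ σ'} → σ ⟶ᵛ σ' → DMatchStep (matchUpdate r (just σ)) (matchUpdate r (just σ'))
  matchUpdate-stepV (bind {a = a} x) st = extend-stepV x a st
  matchUpdate-stepV same st = inj₂ (_ , _ , refl , refl , st)
  matchUpdate-stepV decomp st = inj₂ (_ , _ , refl , refl , st)
  matchUpdate-stepV (fail f) st = inj₁ refl

  data VecStep : ∀ {k} → Vec Term k → Vec Term k → Set where
    headStep : ∀ {k s t} {τ : Vec Term k} → s ⟶ t → VecStep (s ∷ τ) (t ∷ τ)
    tailStep : ∀ {k x} {τ τ' : Vec Term k} → VecStep τ τ' → VecStep (x ∷ τ) (x ∷ τ')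

  allJust-stepV : ∀ {k} {σ σ' : Vec (Maybe Term) k} → σ ⟶ᵛ σ' → ∀ {τ} → allJust σ ≡ just τ →
    Σ _ λ τ' → allJust σ' ≡ just τ' × VecStep τ τ'
  allJust-stepV (here {σ = σ} st) e with allJust σ
  allJust-stepV (here {σ = σ} st) refl | just τ0 = _ , refl , headStep st
  allJust-stepV (there {x = nothing} st) ()
  allJust-stepV (there {x = just u} {σ} st) e with allJust σ in e0
  allJust-stepV (there {x = just u} {σ} st) refl | just τ0 with allJust-stepV st e0
  ... | τ1 , e1 , vs rewrite e1 = _ , refl , tailStep vs

  allJust-stepV-nothing : ∀ {k} {σ σ' : Vec (Maybe Term) k} → σ ⟶ᵛ σ' → allJust σ ≡ nothing → allJust σ' ≡ nothing
  allJust-stepV-nothing (here {σ = σ} st) e with allJust σ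
  allJust-stepV-nothing (here {σ = σ} st) refl | nothing = refl
  allJust-stepV-nothing (there {x = nothing} st) e = refl
  allJust-stepV-nothing (there {x = just u} {σ} st) e with allJust σ in e0
  allJust-stepV-nothing (there {x = just u} {σ} st) refl | nothing rewrite allJust-stepV-nothing st e0 = refl

  lookupℕ-vecStep : ∀ {k} {τ τ' : Vec Term k} → VecStep τ τ' → ∀ j →
    lookupℕ τ j ≡ lookupℕ τ' j ⊎ Σ Term λ u → Σ Term λ u' → lookupℕ τ j ≡ just u × lookupℕ τ' j ≡ just u' × u ⟶ u'
  lookupℕ-vecStep (headStep st) zero = inj₂ (_ , _ , refl , refl , st)
  lookupℕ-vecStep (headStep st) (suc j) = inj₁ refl
  lookupℕ-vecStep (tailStep vs) zero = inj₁ refl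
  lookupℕ-vecStep (tailStep vs) (suc j) = lookupℕ-vecStep vs j

  module _ {k} {τ τ' : Vec Term k} (vs : VecStep τ τ') where
    sub-var-vecStep : ∀ c m i → sub c m τ (var i) ⟶* sub c m τ' (var i)
    sub-var-vecStep c m i with i <? c
    ... | yes h rewrite sub-var-< {k} {c} {m} {τ} {i} h | sub-var-< {k} {c} {m} {τ'} {i} h = ε
    ... | no h with lookupℕ-vecStep vs (i ∸ c)
    ...   | inj₂ (u , u' , e1 , e2 , st) rewrite sub-var-just {k} {c} {m} {τ} {i} (≮⇒≥ h) e1 | sub-var-just {k} {c} {m} {τ'} {i} (≮⇒≥ h) e2 =
            shV-step bot cl 0 c (shM-step bot cl 0 m st) ◅ ε
    ...   | inj₁ eq with lookupℕ τ (i ∸ c) in e1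
    ...     | just u rewrite sub-var-just {k} {c} {m} {τ} {i} (≮⇒≥ h) e1 | sub-var-just {k} {c} {m} {τ'} {i} {u} (≮⇒≥ h) (sym eq) = ε
    ...     | nothing rewrite sub-var-nothing {k} {c} {m} {τ} {i} (≮⇒≥ h) e1 | sub-var-nothing {k} {c} {m} {τ'} {i} (≮⇒≥ h) (sym eq) = ε

    mutual
      sub-vecStep : ∀ t c m → sub c m τ t ⟶* sub c m τ' t
      sub-vecStep (var i) c m = sub-var-vecStep c m i
      sub-vecStep (mat i) c m = ε
      sub-vecStep (app s t) c m = gmap (λ x → app x _) appL (sub-vecStep s c m) ◅◅ gmap (app _) appR (sub-vecStep t c m)
      sub-vecStep (sapp s t) c m = gmap (λ x → sapp x _) sappL (sub-vecStep s c m) ◅◅ gmap (sapp _) sappR (sub-vecStep t c m)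
      sub-vecStep (abs j p b) c m = gmap (λ x → abs j x _) absP (sub-vecStep p c (j + m)) ◅◅ gmap (abs j _) absB (sub-vecStep b (j + c) m)
      sub-vecStep (em j b μ Δ) c m =
        gmap (λ x → em j x _ _) emB (sub-vecStep b (j + c) m) ◅◅ (subμ-vecStep j μ c m ◅◅ gmap (em j _ _) emΔ (subΔ-vecStep j Δ c m))

      subμ-vecStep : ∀ j (μ : DMatch j) c m {b Δ} → em j b (subμ c m τ μ) Δ ⟶* em j b (subμ c m τ' μ) Δ
      subμ-vecStep j nothing c m = ε
      subμ-vecStep j (just σ) c m = gmap (λ x → em j _ (just x) _) emμ (subv-vecStep σ c m)

      subv-vecStep : ∀ {j} (σ : Vec (Maybe Term) j) c m → Star _⟶ᵛ_ (subv c m τ σ) (subv c m τ' σ)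
      subv-vecStep [] c m = ε
      subv-vecStep (nothing ∷ σ) c m = gmap (nothing ∷_) there (subv-vecStep σ c m)
      subv-vecStep (just t ∷ σ) c m = gmap (λ x → just x ∷ _) here (sub-vecStep t c m) ◅◅ gmap (_ ∷_) there (subv-vecStep σ c m)

      subΔ-vecStep : ∀ j Δ c m → Star _⟶Δ_ (subΔ j c m τ Δ) (subΔ j c m τ' Δ)
      subΔ-vecStep j [] c m = ε
      subΔ-vecStep j ((a , p) ∷ Δ) c m =
        gmap (λ x → (x , _) ∷ _) fstS (sub-vecStep a c m) ◅◅
        (gmap (λ x → (_ , x) ∷ _) sndS (sub-vecStep p c (j + m)) ◅◅ gmap (_ ∷_) there (subΔ-vecStep j Δ c m))

  step-≡ : ∀ {a b c} → a ⟶ b → b ≡ c → a ⟶* c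
  step-≡ st refl = st ◅ ε

  matchSteps-disjoint : ∀ {k b μ x y μ1 μ2 xs ys} (Δ₁ Γ Δ₂ : List (Term × Term)) (r1 : MatchStep k μ x μ1 xs) (r2 : MatchStep k μ y μ2 ys) →
    Joinable _⟶_ (em k b μ1 (Δ₁ ++ xs ++ Γ ++ y ∷ Δ₂)) (em k b μ2 ((Δ₁ ++ x ∷ Γ) ++ ys ++ Δ₂))
  matchSteps-disjoint {k} {b} {μ} {x} {y} {μ1} {μ2} {xs} {ys} Δ₁ Γ Δ₂ r1 r2 =
    em k b (matchUpdate r1 μ2) (Δ₁ ++ xs ++ Γ ++ ys ++ Δ₂) ,
    step-≡ (root (fromRootView (view-match {Δ₁ = Δ₁ ++ xs ++ Γ} L1 (matchStep-at r2 μ1))))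
           (cong₂ (em k b) μeq L3) ,
    step-≡ (root (fromRootView (view-match {Δ₁ = Δ₁} L2 (matchStep-at r1 μ2)))) refl
    where
    L1 : Δ₁ ++ xs ++ Γ ++ y ∷ Δ₂ ≡ (Δ₁ ++ xs ++ Γ) ++ y ∷ Δ₂
    L1 = trans (cong (Δ₁ ++_) (sym (++-assoc xs Γ (y ∷ Δ₂)))) (sym (++-assoc Δ₁ (xs ++ Γ) (y ∷ Δ₂)))
    L2 : (Δ₁ ++ x ∷ Γ) ++ ys ++ Δ₂ ≡ Δ₁ ++ x ∷ Γ ++ ys ++ Δ₂
    L2 = ++-assoc Δ₁ (x ∷ Γ) (ys ++ Δ₂)
    L3 : (Δ₁ ++ xs ++ Γ) ++ ys ++ Δ₂ ≡ Δ₁ ++ xs ++ Γ ++ ys ++ Δ₂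
    L3 = trans (++-assoc Δ₁ (xs ++ Γ) (ys ++ Δ₂)) (cong (Δ₁ ++_) (++-assoc xs Γ (ys ++ Δ₂)))
    μeq : matchUpdate r2 μ1 ≡ matchUpdate r1 μ2
    μeq = trans (cong (matchUpdate r2) (sym (matchUpdate-self r1))) (trans (sym (matchUpdate-comm r1 r2 μ)) (cong (matchUpdate r1) (matchUpdate-self r2)))

  root-root-joinable : ∀ {s t u} → RootView bot s t → RootView bot s u → Joinable _⟶_ t u
  root-root-joinable view-bullet-mat view-bullet-mat = _ , ε , ε
  root-root-joinable view-bullet-sapp view-bullet-sapp = _ , ε , ε
  root-root-joinable (view-match {Δ₁ = Δ₁} {x} {Δ₂} e1 r1) (view-match {Δ₁ = Δ₁'} {y} {Δ₂'} e2 r2) with posView Δ₁ x Δ₂ Δ₁' y Δ₂' (trans (sym e1) e2)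
  ... | samePos with matchStep-deterministic r1 r2 refl
  ...   | refl , refl = _ , ε , ε
  root-root-joinable (view-match {Δ₁ = Δ₁} {x} {Δ₂} e1 r1) (view-match {Δ₁ = Δ₁'} {y} {Δ₂'} e2 r2) | leftPos {Γ = Γ} = matchSteps-disjoint Δ₁ Γ Δ₂' r1 r2
  root-root-joinable (view-match {Δ₁ = Δ₁} {x} {Δ₂} e1 r1) (view-match {Δ₁ = Δ₁'} {y} {Δ₂'} e2 r2) | rightPos {Γ = Γ} = Joinable-sym (matchSteps-disjoint Δ₁' Γ Δ₂ r2 r1)
  root-root-joinable (view-match e r) (view-subst _) = ⊥-elim ([]≢++∷ _ _ _ e)
  root-root-joinable (view-match e r) (view-dom _) = ⊥-elim ([]≢++∷ _ _ _ e)
  root-root-joinable (view-match e r) view-fail rewrite matchStep-from-⊥ r = bot , root r-fail ◅ ε , ε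
  root-root-joinable (view-subst _) (view-match e r) = ⊥-elim ([]≢++∷ _ _ _ e)
  root-root-joinable (view-subst e1) (view-subst e2) with trans (sym e1) e2
  ... | refl = _ , ε , ε
  root-root-joinable (view-subst e1) (view-dom e2) with trans (sym e1) e2
  ... | ()
  root-root-joinable (view-dom _) (view-match e r) = ⊥-elim ([]≢++∷ _ _ _ e)
  root-root-joinable (view-dom e1) (view-subst e2) with trans (sym e1) e2
  ... | ()
  root-root-joinable (view-dom e1) (view-dom e2) = _ , ε , ε
  root-root-joinable view-fail (view-match e r) rewrite matchStep-from-⊥ r = bot , ε , root r-fail ◅ ε
  root-root-joinable view-fail view-fail = _ , ε , ε

  match-pair-joinable : ∀ {k b μ x x' μ' ys} (Δ₁ Δ₂ : List (Term × Term)) → MatchStep k μ x μ' ys → PairStep x x' →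
    Joinable _⟶_ (em k b μ' (Δ₁ ++ ys ++ Δ₂)) (em k b μ (Δ₁ ++ x' ∷ Δ₂))
  match-pair-joinable {μ = μ} Δ₁ Δ₂ (bind x) (argStep st) = _ , DMatchStep-em (extend-step μ x st) , root (m-bind x) ◅ ε
  match-pair-joinable Δ₁ Δ₂ (bind x) (patStep st) = ⊥-elim (mat-irreducible st)
  match-pair-joinable Δ₁ Δ₂ same (argStep st) = ⊥-elim (mat-irreducible st)
  match-pair-joinable Δ₁ Δ₂ same (patStep st) = ⊥-elim (mat-irreducible st)
  match-pair-joinable Δ₁ Δ₂ decomp (argStep st) with sapp-step-view st
  ... | inj₁ (_ , refl , st') = _ , emΔ (stepΔ-++ʳ Δ₁ (fstS st')) ◅ ε , root m-decomp ◅ ε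
  ... | inj₂ (_ , refl , st') = _ , emΔ (stepΔ-++ʳ Δ₁ (there (fstS st'))) ◅ ε , root m-decomp ◅ ε
  match-pair-joinable Δ₁ Δ₂ decomp (patStep st) with sapp-step-view st
  ... | inj₁ (_ , refl , st') = _ , emΔ (stepΔ-++ʳ Δ₁ (sndS st')) ◅ ε , root m-decomp ◅ ε
  ... | inj₂ (_ , refl , st') = _ , emΔ (stepΔ-++ʳ Δ₁ (there (sndS st'))) ◅ ε , root m-decomp ◅ ε
  match-pair-joinable Δ₁ Δ₂ (fail f) (argStep st) = _ , ε , root (m-fail (Fails-stepᵃ f st)) ◅ ε
  match-pair-joinable Δ₁ Δ₂ (fail f) (patStep st) = _ , ε , root (m-fail (Fails-stepᵖ f st)) ◅ ε

  root-step-joinable : ∀ {s t u} → RootView bot s t → s ⟶ u → Joinable _⟶_ t u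
  root-step-joinable r (root r2) = root-root-joinable r (toRootView r2)
  root-step-joinable view-bullet-mat (appL st) = ⊥-elim (mat-irreducible st)
  root-step-joinable view-bullet-mat (appR st) = _ , sappR st ◅ ε , root bullet-mat ◅ ε
  root-step-joinable view-bullet-sapp (appL st) with sapp-step-view st
  ... | inj₁ (_ , refl , _) = _ , sappL st ◅ ε , root bullet-sapp ◅ ε
  ... | inj₂ (_ , refl , _) = _ , sappL st ◅ ε , root bullet-sapp ◅ ε
  root-step-joinable view-bullet-sapp (appR st) = _ , sappR st ◅ ε , root bullet-sapp ◅ ε
  root-step-joinable (view-match e r) (emB st) = _ , emB st ◅ ε , root (fromRootView (view-match e r)) ◅ ε
  root-step-joinable {s = em k b (just σ) Δ} (view-match {Δ₁ = Δ₁} {x} {Δ₂} {ys = ys} e r) (emμ {σ' = σ'} st) =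
    em k b (matchUpdate r (just σ')) (Δ₁ ++ ys ++ Δ₂) ,
        subst (λ z → em k b z (Δ₁ ++ ys ++ Δ₂) ⟶* em k b (matchUpdate r (just σ')) (Δ₁ ++ ys ++ Δ₂)) (matchUpdate-self r) (DMatchStep-em (matchUpdate-stepV r st)) ,
        root (fromRootView (view-match e (matchStep-at r (just σ')))) ◅ ε
  root-step-joinable (view-match {Δ₁ = Δ₁} {x} {Δ₂} {ys = ys} refl r) (emΔ st) with appView Δ₁ x Δ₂ st
  ... | inL s = _ , emΔ (stepΔ-++ˡ (ys ++ Δ₂) s) ◅ ε , root (matchStep-root r) ◅ ε
  ... | inR s = _ , emΔ (stepΔ-++ʳ Δ₁ (stepΔ-++ʳ ys s)) ◅ ε , root (matchStep-root r) ◅ ε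
  ... | inM ps = match-pair-joinable Δ₁ Δ₂ r ps
  root-step-joinable (view-subst {τ = τ} eq) (emB st) = _ , sub-step bot cl 0 0 τ st ◅ ε , root (r-subst eq) ◅ ε
  root-step-joinable (view-subst {b = b} eq) (emμ st) with allJust-stepV st eq
  ... | τ' , e' , vs = _ , sub-vecStep vs b 0 0 , root (r-subst e') ◅ ε
  root-step-joinable (view-subst eq) (emΔ ())
  root-step-joinable (view-dom eq) (emB st) = _ , ε , root (r-dom eq) ◅ ε
  root-step-joinable (view-dom eq) (emμ st) = _ , ε , root (r-dom (allJust-stepV-nothing st eq)) ◅ ε
  root-step-joinable (view-dom eq) (emΔ ())
  root-step-joinable view-fail (emB st) = _ , ε , root r-fail ◅ ε
  root-step-joinable view-fail (emΔ st) = _ , ε , root r-fail ◅ ε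

  mutual
    local-confluence : ∀ {s t u} → s ⟶ t → s ⟶ u → Joinable _⟶_ t u
    local-confluence (root r1) st2 = root-step-joinable (toRootView r1) st2
    local-confluence st1 (root r2) = Joinable-sym (root-step-joinable (toRootView r2) st1)
    local-confluence (appL a) (appL b) = Joinable-map (λ x → app x _) appL (local-confluence a b)
    local-confluence (appL a) (appR b) = _ , appR b ◅ ε , appL a ◅ ε
    local-confluence (appR a) (appL b) = _ , appL b ◅ ε , appR a ◅ ε
    local-confluence (appR a) (appR b) = Joinable-map (app _) appR (local-confluence a b)
    local-confluence (sappL a) (sappL b) = Joinable-map (λ x → sapp x _) sappL (local-confluence a b)
    local-confluence (sappL a) (sappR b) = _ , sappR b ◅ ε , sappL a ◅ ε
    local-confluence (sappR a) (sappL b) = _ , sappL b ◅ ε , sappR a ◅ ε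
    local-confluence (sappR a) (sappR b) = Joinable-map (sapp _) sappR (local-confluence a b)
    local-confluence (absP a) (absP b) = Joinable-map (λ x → abs _ x _) absP (local-confluence a b)
    local-confluence (absP a) (absB b) = _ , absB b ◅ ε , absP a ◅ ε
    local-confluence (absB a) (absP b) = _ , absP b ◅ ε , absB a ◅ ε
    local-confluence (absB a) (absB b) = Joinable-map (abs _ _) absB (local-confluence a b)
    local-confluence (emB a) (emB b) = Joinable-map (λ x → em _ x _ _) emB (local-confluence a b)
    local-confluence (emB a) (emμ b) = _ , emμ b ◅ ε , emB a ◅ ε
    local-confluence (emB a) (emΔ b) = _ , emΔ b ◅ ε , emB a ◅ ε
    local-confluence (emμ a) (emB b) = _ , emB b ◅ ε , emμ a ◅ ε
    local-confluence (emμ a) (emμ b) = Joinable-map (λ z → em _ _ (just z) _) emμ (local-confluenceV a b)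
    local-confluence (emμ a) (emΔ b) = _ , emΔ b ◅ ε , emμ a ◅ ε
    local-confluence (emΔ a) (emB b) = _ , emB b ◅ ε , emΔ a ◅ ε
    local-confluence (emΔ a) (emμ b) = _ , emμ b ◅ ε , emΔ a ◅ ε
    local-confluence (emΔ a) (emΔ b) = Joinable-map (em _ _ _) emΔ (local-confluenceΔ a b)

    local-confluenceV : ∀ {k} {σ σ1 σ2 : Vec (Maybe Term) k} → σ ⟶ᵛ σ1 → σ ⟶ᵛ σ2 → Joinable _⟶ᵛ_ σ1 σ2
    local-confluenceV (here a) (here b) = Joinable-map (λ z → just z ∷ _) here (local-confluence a b)
    local-confluenceV (here a) (there b) = _ , there b ◅ ε , here a ◅ ε
    local-confluenceV (there a) (here b) = _ , here b ◅ ε , there a ◅ ε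
    local-confluenceV (there a) (there b) = Joinable-map (_ ∷_) there (local-confluenceV a b)

    local-confluenceΔ : ∀ {Δ Δ1 Δ2} → Δ ⟶Δ Δ1 → Δ ⟶Δ Δ2 → Joinable _⟶Δ_ Δ1 Δ2
    local-confluenceΔ (fstS a) (fstS b) = Joinable-map (λ z → (z , _) ∷ _) fstS (local-confluence a b)
    local-confluenceΔ (fstS a) (sndS b) = _ , sndS b ◅ ε , fstS a ◅ ε
    local-confluenceΔ (fstS a) (there b) = _ , there b ◅ ε , fstS a ◅ ε
    local-confluenceΔ (sndS a) (fstS b) = _ , fstS b ◅ ε , sndS a ◅ ε
    local-confluenceΔ (sndS a) (sndS b) = Joinable-map (λ z → (_ , z) ∷ _) sndS (local-confluence a b)
    local-confluenceΔ (sndS a) (there b) = _ , there b ◅ ε , sndS a ◅ ε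
    local-confluenceΔ (there a) (fstS b) = _ , fstS b ◅ ε , there a ◅ ε
    local-confluenceΔ (there a) (sndS b) = _ , sndS b ◅ ε , there a ◅ ε
    local-confluenceΔ (there a) (there b) = Joinable-map (_ ∷_) there (local-confluenceΔ a b)

newman : ∀ {A : Set} {_⟶_ : A → A → Set} → WellFounded (flip _⟶_) →
  (∀ {s t u} → s ⟶ t → s ⟶ u → Joinable _⟶_ t u) →
  ∀ {s t u} → Star _⟶_ s t → Star _⟶_ s u → Joinable _⟶_ t u
newman {_⟶_ = _⟶_} wf local = go (wf _)
  where
  go : ∀ {s t u} → Acc (flip _⟶_) s → Star _⟶_ s t → Star _⟶_ s u → Joinable _⟶_ t u
  go _ ε q = _ , q , ε
  go _ (a ◅ p) ε = _ , ε , a ◅ p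
  go (acc rs) (a ◅ p) (b ◅ q) with local a b
  ... | v , t₁v , u₁v with go (rs a) p t₁v
  ...   | w , tw , vw with go (rs b) q (u₁v ◅◅ vw)
  ...     | z , uz , wz = z , tw ◅◅ wz , uz

mainTheorem1 : (bot : Term) → Closed bot → NoSappEm bot →
  Normal (λ s t → s ⟶[ bot ] t) bot →
  Confluent (λ s t → s ⟶p[ bot ] t) × StronglyNormalizing (λ s t → s ⟶p[ bot ] t)
mainTheorem1 bot closed pure _ =
  newman (⟶p-SN bot closed pure) (LocalConfluence.local-confluence closed) , ⟶p-SN bot closed pure
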